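{- Let $\Phi$ be a graph subspecies in which every graph is connected, and assume $\Phi$ is closed under creating and deleting endpoints. Let $\mathcal{A}$ be the species of rooted trees, $a$ the species of (unrooted) trees, $\Phi_{\mathcal{M}}$ the species of $\Phi$-graphs without endpoints, and $\Phi_{\mathcal{M}_{\ge 2}}$ the species of $\Phi_{\mathcal{M}}$-graphs on at least two vertices. Then $$\Phi=\begin{cases}\Phi_{\mathcal{M}_{\ge2}}\circ\mathcal{A}+a & \text{if the one-vertex graph is a }\Phi\text{ -graph},\\ \Phi_{\mathcal{M}}\circ\mathcal{A} & \text{otherwise.}\end{cases}$$
   Context: Graphs are finite, simple, undirected; the empty graph is not considered connected. A graph subspecies $\Phi$ assigns to each finite set $U$ a set $\Phi[U]$ of graphs with vertex set $U$, preserved under relabeling; its members are $\Phi$-graphs. An endpoint is a vertex of degree exactly $1$; a graph without endpoints has no vertex of degree $1$. $\Phi$ is closed under creating and deleting endpoints if for every graph $G$ and every endpoint $v$ of $G$, $G$ is a $\Phi$-graph iff $G-v$ is a $\Phi$-graph. Species sum $\mathcal{F}+\mathcal{H}$ has structures the disjoint union $\mathcal{F}[U]\sqcup\mathcal{H}[U]$; for $\mathcal{H}[\emptyset]=\emptyset$, $(\mathcal{F}\circ\mathcal{H})$-structures on $U$ are pairs $(s,T)$ with $T$ a set of $\mathcal{H}$-structures whose label sets partition $U$ and $s\in\mathcal{F}[T]$. Equality of species means natural isomorphism (bijections commuting with relabeling). -}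

module Defs where

open import Data.Bool using (Bool; true; false; not; T)
open import Data.Bool.Properties using (T-irrelevant)
open import Data.Unit using (⊤; tt)
open import Data.Empty using (⊥; ⊥-elim)
open import Data.Nat using (ℕ; zero; suc; _≤_)
open import Data.Fin using (Fin)
open import Data.Fin.Properties renaming (_≟_ to _≟F_)
open import Data.List using (List; []; _∷_; _++_; length; map; allFin)
open import Data.List.Properties using (map-++; length-map)
open import Data.List.Membership.Propositional using (_∈_)
open import Data.List.Membership.Propositional.Properties using (∈-allFin)
open import Data.List.Relation.Unary.Any using (here; there)
open import Data.List.Relation.Unary.Unique.Propositional using (Unique)
import Data.List.Relation.Unary.Unique.Propositional.Properties as UniqueP
open import Data.List.Relation.Unary.Linked using (Linked)
import Data.List.Relation.Unary.Linked.Properties as LinkedP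
open import Data.Product using (Σ; _×_; _,_; proj₁; proj₂)
open import Data.Sum using (_⊎_; inj₁; inj₂)
open import Relation.Nullary using (¬_; yes; no)
open import Relation.Nullary.Decidable using (⌊_⌋; toWitness; fromWitness)
open import Relation.Binary.PropositionalEquality
open import Relation.Binary.Definitions using (DecidableEquality)
open import Relation.Binary.Construct.Closure.ReflexiveTransitive using (Star; gmap)

record FinSet : Set₁ where
  field
    Carrier  : Set
    _≟_      : DecidableEquality Carrier
    elems    : List Carrier
    complete : ∀ x → x ∈ elems
open FinSet public

record Bij (U V : FinSet) : Set where
  field
    to      : Carrier U → Carrier V
    from    : Carrier V → Carrier U
    from∘to : ∀ x → from (to x) ≡ x
    to∘from : ∀ y → to (from y) ≡ y
open Bij public

FinS : ℕ → FinSet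
FinS k = record { Carrier = Fin k ; _≟_ = _≟F_ ; elems = allFin k ; complete = ∈-allFin }

module _ (U : FinSet) (p : Carrier U → Bool) where
  SubC : Set
  SubC = Σ (Carrier U) (λ u → T (p u))

  private
    step : (x : Carrier U) (b : Bool) → p x ≡ b → List SubC → List SubC
    step x true  eq r = (x , subst T (sym eq) tt) ∷ r
    step x false eq r = r

    subElems : List (Carrier U) → List SubC
    subElems []       = []
    subElems (x ∷ xs) = step x (p x) refl (subElems xs)

    stepHere : ∀ x (t : T (p x)) b (eq : p x ≡ b) r → (x , t) ∈ step x b eq r
    stepHere x t true  eq r = here (cong (x ,_) (T-irrelevant t _))
    stepHere x t false eq r = ⊥-elim (subst T eq t)

    stepThere : ∀ {u} x b (eq : p x ≡ b) r → u ∈ r → u ∈ step x b eq r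
    stepThere x true  eq r m = there m
    stepThere x false eq r m = m

    subComplete : ∀ (u : SubC) xs → proj₁ u ∈ xs → u ∈ subElems xs
    subComplete (u , t) (x ∷ xs) (here refl) = stepHere x t (p x) refl (subElems xs)
    subComplete u (x ∷ xs) (there m) = stepThere x (p x) refl (subElems xs) (subComplete u xs m)

    subDec : DecidableEquality SubC
    subDec (u , t) (u' , t') with (U ≟ u) u'
    ... | yes refl = yes (cong (u ,_) (T-irrelevant t t'))
    ... | no ne = no (λ e → ne (cong proj₁ e))

  Sub : FinSet
  Sub = record { Carrier = SubC ; _≟_ = subDec ; elems = subElems (elems U)
               ; complete = λ u → subComplete u (elems U) (complete U (proj₁ u)) }

subEq : ∀ {U p} {a b : SubC U p} → proj₁ a ≡ proj₁ b → a ≡ b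
subEq {a = u , t} {b = .u , t'} refl = cong (u ,_) (T-irrelevant t t')

_─_ : (U : FinSet) → Carrier U → FinSet
U ─ v = Sub U (λ u → not ⌊ (U ≟ u) v ⌋)

record Graph (U : FinSet) : Set where
  field
    adj    : Carrier U → Carrier U → Bool
    adj-sym    : ∀ x y → adj x y ≡ adj y x
    adj-irrefl : ∀ x → adj x x ≡ false
open Graph public

_≈G_ : ∀ {U} → Graph U → Graph U → Set
G ≈G H = ∀ x y → adj G x y ≡ adj H x y

Adj : ∀ {U} → Graph U → Carrier U → Carrier U → Set
Adj G x y = adj G x y ≡ true

relabelG : ∀ {U V} → Bij U V → Graph U → Graph V
relabelG σ G = record
  { adj = λ v w → adj G (from σ v) (from σ w)
  ; adj-sym = λ v w → adj-sym G (from σ v) (from σ w)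
  ; adj-irrefl = λ v → adj-irrefl G (from σ v) }

_─G_ : ∀ {U} (G : Graph U) (v : Carrier U) → Graph (U ─ v)
G ─G v = record
  { adj = λ x y → adj G (proj₁ x) (proj₁ y)
  ; adj-sym = λ x y → adj-sym G (proj₁ x) (proj₁ y)
  ; adj-irrefl = λ x → adj-irrefl G (proj₁ x) }

edgeless : (U : FinSet) → Graph U
edgeless U = record { adj = λ _ _ → false ; adj-sym = λ _ _ → refl ; adj-irrefl = λ _ → refl }

oneVertexGraph : Graph (FinS 1)
oneVertexGraph = edgeless (FinS 1)

Connected : ∀ {U} → Graph U → Set
Connected {U} G = Carrier U × (∀ x y → Star (Adj G) x y)

HasCycle : ∀ {U} → Graph U → Set
HasCycle {U} G = Σ (Carrier U) λ x → Σ (List (Carrier U)) λ ys →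
  2 ≤ length ys × Unique (x ∷ ys) × Linked (Adj G) (x ∷ ys ++ x ∷ [])

IsTree : ∀ {U} → Graph U → Set
IsTree G = Connected G × ¬ HasCycle G

Endpoint : ∀ {U} → Graph U → Carrier U → Set
Endpoint {U} G v = Σ (Carrier U) λ w → Adj G v w × (∀ y → Adj G v y → y ≡ w)

NoEndpoints : ∀ {U} → Graph U → Set
NoEndpoints {U} G = ∀ (v : Carrier U) → ¬ Endpoint G v

AtLeastTwo : FinSet → Set
AtLeastTwo U = Σ (Carrier U) λ x → Σ (Carrier U) λ y → ¬ x ≡ y

module _ {U V : FinSet} (σ : Bij U V) where
  private
    inj-from : ∀ {a b} → from σ a ≡ from σ b → a ≡ b
    inj-from {a} {b} e = trans (sym (to∘from σ a)) (trans (cong (to σ) e) (to∘from σ b))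

    adjTo : (G : Graph U) → ∀ a b → Adj G a b → Adj (relabelG σ G) (to σ a) (to σ b)
    adjTo G a b e rewrite from∘to σ a | from∘to σ b = e

  relabel-Connected : (G : Graph U) → Connected G → Connected (relabelG σ G)
  relabel-Connected G (u , c) = to σ u , λ x y →
    subst₂ (Star (Adj (relabelG σ G))) (to∘from σ x) (to∘from σ y)
      (gmap (to σ) (λ {a} {b} → adjTo G a b) (c (from σ x) (from σ y)))

  relabel-NoCycle : (G : Graph U) → ¬ HasCycle G → ¬ HasCycle (relabelG σ G)
  relabel-NoCycle G nc (x , ys , l , u , k) =
    nc (from σ x , map (from σ) ys
       , subst (2 ≤_) (sym (length-map (from σ) ys)) l
       , UniqueP.map⁺ inj-from u
       , subst (Linked (Adj G)) (cong (from σ x ∷_) (map-++ (from σ) ys (x ∷ [])))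
               (LinkedP.map⁺ k))

  relabel-Tree : (G : Graph U) → IsTree G → IsTree (relabelG σ G)
  relabel-Tree G (c , nc) = relabel-Connected G c , relabel-NoCycle G nc

  relabel-NoEndpoints : (G : Graph U) → NoEndpoints G → NoEndpoints (relabelG σ G)
  relabel-NoEndpoints G ne v (w , a , uq) =
    ne (from σ v) (from σ w , a , λ y ay →
      trans (sym (from∘to σ y))
        (cong (from σ) (uq (to σ y) (subst (λ z → Adj G (from σ v) z) (sym (from∘to σ y)) ay))))

  relabel-AtLeastTwo : AtLeastTwo U → AtLeastTwo V
  relabel-AtLeastTwo (x , y , ne) = to σ x , to σ y , λ e →
    ne (trans (sym (from∘to σ x)) (trans (cong (from σ) e) (from∘to σ y)))

record Species : Set₁ where
  field
    Str     : FinSet → Set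
    _≈_     : ∀ {U} → Str U → Str U → Set
    relabel : ∀ {U V} → Bij U V → Str U → Str V
open Species public

record _≅_ (F G : Species) : Set₁ where
  field
    to       : ∀ {U} → Str F U → Str G U
    from     : ∀ {U} → Str G U → Str F U
    to-cong  : ∀ {U} {x y : Str F U} → _≈_ F x y → _≈_ G (to x) (to y)
    from-cong : ∀ {U} {x y : Str G U} → _≈_ G x y → _≈_ F (from x) (from y)
    from∘to  : ∀ {U} (x : Str F U) → _≈_ F (from (to x)) x
    to∘from  : ∀ {U} (y : Str G U) → _≈_ G (to (from y)) y
    natural  : ∀ {U V} (σ : Bij U V) (x : Str F U) →
               _≈_ G (to (relabel F σ x)) (relabel G σ (to x))

_+ₛ_ : Species → Species → Species
F +ₛ H = record
  { Str = λ U → Str F U ⊎ Str H U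
  ; _≈_ = λ { (inj₁ x) (inj₁ y) → _≈_ F x y ; (inj₂ x) (inj₂ y) → _≈_ H x y
            ; _ _ → ⊥ }
  ; relabel = λ { σ (inj₁ x) → inj₁ (relabel F σ x) ; σ (inj₂ x) → inj₂ (relabel H σ x) } }

graphSpecies : (Q : ∀ U → Graph U → Set) →
               (∀ {U V} (σ : Bij U V) G → Q U G → Q V (relabelG σ G)) → Species
graphSpecies Q cl = record
  { Str = λ U → Σ (Graph U) (Q U)
  ; _≈_ = λ x y → proj₁ x ≈G proj₁ y
  ; relabel = λ σ x → relabelG σ (proj₁ x) , cl σ (proj₁ x) (proj₂ x) }

treeSpecies : Species
treeSpecies = graphSpecies (λ U G → IsTree G) (λ σ G → relabel-Tree σ G)

rootedTreeSpecies : Species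
rootedTreeSpecies = record
  { Str = λ U → Σ (Graph U) (λ G → IsTree G × Carrier U)
  ; _≈_ = λ x y → (proj₁ x ≈G proj₁ y) × (proj₂ (proj₂ x) ≡ proj₂ (proj₂ y))
  ; relabel = λ σ x → relabelG σ (proj₁ x)
                    , relabel-Tree σ (proj₁ x) (proj₁ (proj₂ x)) , to σ (proj₂ (proj₂ x)) }

-- A partition of U into k nonempty blocks is a
-- surjection blk : U → Fin k; each block carries an H-structure and the
-- set of blocks carries an F-structure.  Two such data are equal when a
-- bijection of the block index sets matches blocks, H-structures and
-- the F-structure (so the block indexing is immaterial).

Fiber : (U : FinSet) {k : ℕ} → (Carrier U → Fin k) → Fin k → FinSet
Fiber U blk i = Sub U (λ u → ⌊ blk u ≟F i ⌋)

record CompStr (F H : Species) (U : FinSet) : Set where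
  field
    k    : ℕ
    blk  : Carrier U → Fin k
    surj : ∀ i → Σ (Carrier U) λ u → blk u ≡ i
    str  : ∀ i → Str H (Fiber U blk i)
    top  : Str F (FinS k)
open CompStr public

fibBij : ∀ {U k k'} {blk : Carrier U → Fin k} {blk' : Carrier U → Fin k'}
         (β : Bij (FinS k) (FinS k')) → (∀ u → blk' u ≡ to β (blk u)) →
         ∀ i → Bij (Fiber U blk i) (Fiber U blk' (to β i))
fibBij {U} {blk = blk} {blk'} β c i = record
  { to = λ x → proj₁ x , fromWitness (trans (c (proj₁ x)) (cong (to β) (toWitness (proj₂ x))))
  ; from = λ x → proj₁ x , fromWitness
      (trans (sym (from∘to β (blk (proj₁ x))))
        (trans (cong (from β) (sym (c (proj₁ x))))
          (trans (cong (from β) (toWitness (proj₂ x))) (from∘to β i))))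
  ; from∘to = λ x → subEq {U} {λ u → ⌊ blk u ≟F i ⌋} refl
  ; to∘from = λ x → subEq {U} {λ u → ⌊ blk' u ≟F to β i ⌋} refl }

fibRelabel : ∀ {U V k} (σ : Bij U V) (blk : Carrier U → Fin k) →
             ∀ i → Bij (Fiber U blk i) (Fiber V (λ v → blk (from σ v)) i)
fibRelabel {U} {V} σ blk i = record
  { to = λ x → to σ (proj₁ x)
             , subst (λ z → T ⌊ blk z ≟F i ⌋) (sym (from∘to σ (proj₁ x))) (proj₂ x)
  ; from = λ x → from σ (proj₁ x) , proj₂ x
  ; from∘to = λ x → subEq {U} {λ u → ⌊ blk u ≟F i ⌋} (from∘to σ (proj₁ x))
  ; to∘from = λ x → subEq {V} {λ v → ⌊ blk (from σ v) ≟F i ⌋} (to∘from σ (proj₁ x)) }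

_∘ₛ_ : Species → Species → Species
F ∘ₛ H = record
  { Str = CompStr F H
  ; _≈_ = λ {U} x y → Σ (Bij (FinS (k x)) (FinS (k y))) λ β →
            Σ (∀ u → blk y u ≡ to β (blk x u)) λ c →
              (∀ i → _≈_ H (relabel H (fibBij β c i) (str x i)) (str y (to β i)))
              × _≈_ F (relabel F β (top x)) (top y)
  ; relabel = λ σ x → record
      { k = k x
      ; blk = λ v → blk x (from σ v)
      ; surj = λ i → to σ (proj₁ (surj x i))
                   , trans (cong (blk x) (from∘to σ (proj₁ (surj x i)))) (proj₂ (surj x i))
      ; str = λ i → relabel H (fibRelabel σ (blk x) i) (str x i)
      ; top = top x } }

record GraphSubspecies : Set₁ where
  field
    Is           : (U : FinSet) → Graph U → Set
    relabel-closed : ∀ {U V} (σ : Bij U V) (G : Graph U) → Is U G → Is V (relabelG σ G)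
    -- Φ[U] is a *set of graphs*: membership depends only on the edge set
    ext-closed   : ∀ {U} {G H : Graph U} → G ≈G H → Is U G → Is U H
open GraphSubspecies public

asSpecies : GraphSubspecies → Species
asSpecies Φ = graphSpecies (Is Φ) (relabel-closed Φ)

Φ-M : GraphSubspecies → Species
Φ-M Φ = graphSpecies (λ U G → Is Φ U G × NoEndpoints G)
  (λ σ G p → relabel-closed Φ σ G (proj₁ p) , relabel-NoEndpoints σ G (proj₂ p))

Φ-M≥2 : GraphSubspecies → Species
Φ-M≥2 Φ = graphSpecies (λ U G → (Is Φ U G × NoEndpoints G) × AtLeastTwo U)
  (λ σ G p → (relabel-closed Φ σ G (proj₁ (proj₁ p)) , relabel-NoEndpoints σ G (proj₂ (proj₁ p)))
           , relabel-AtLeastTwo σ (proj₂ p))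

AllConnected : GraphSubspecies → Set₁
AllConnected Φ = ∀ (U : FinSet) (G : Graph U) → Is Φ U G → Connected G

EndpointClosed : GraphSubspecies → Set₁
EndpointClosed Φ = ∀ (U : FinSet) (G : Graph U) (v : Carrier U) → Endpoint G v →
  (Is Φ U G → Is Φ (U ─ v) (G ─G v)) × (Is Φ (U ─ v) (G ─G v) → Is Φ U G)

module Submission where

-- Prune a graph G by repeatedly deleting all vertices with fewer
-- than two neighbours among the remaining ones; what is left after |V(G)|
-- rounds is the core.  (1) Every round deletes pendant vertices, so by
-- endpoint closure G is a Φ-graph iff its core is (or, for an empty core,
-- iff the one-vertex graph is).  (2) The core is nonempty iff G has a
-- cycle; an empty core thus means G is a tree.  (3) For nonempty core,
-- sending every vertex to the core along its "parent" edges splits G into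
-- rooted trees hanging at the core vertices, and G is recovered by gluing
-- these trees along the graph induced on the core, which has no endpoints
-- and at least two vertices.  (4) Conversely the core of a glued graph is
-- its set of roots, so gluing is injective, Φ-preserving and natural.

open import Defs
open import Data.Bool using (Bool; true; false; not; T; _∧_; _∨_; if_then_else_)
open import Data.Bool.Properties using (T-irrelevant; T-≡; T-∧; ∧-conicalˡ; ∧-conicalʳ; ∨-zeroʳ; ∧-zeroʳ; ∧-identityʳ; ∨-identityʳ)
open import Data.Unit using (⊤; tt)
open import Data.Empty using (⊥; ⊥-elim)
open import Data.Nat using (ℕ; zero; suc; _≤_; _<_; z≤n; s≤s; _+_; _∸_)
open import Data.Nat.Properties hiding (_≟_)
open import Data.Fin using (Fin) renaming (zero to fz; suc to fs)
open import Data.Fin.Properties using () renaming (_≟_ to _≟F_)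
open import Data.List using (List; []; _∷_; _++_; length; map; lookup)
open import Data.Bool.ListAction using (any)
open import Data.List.Base using (deduplicate)
open import Data.List.Properties using (map-++; length-map; ++-assoc; length-++; ++-identityʳ)
open import Data.List.Membership.Propositional using (_∈_; _∉_)
open import Data.List.Membership.Propositional.Properties using (∈-lookup; ∈-++⁺ˡ; ∈-++⁺ʳ; ∈-++⁻)
open import Data.List.Relation.Unary.All.Properties using (All¬⇒¬Any; ¬Any⇒All¬)
open import Data.List.Relation.Unary.Any using (here; there; index)
import Data.List.Relation.Unary.Any.Properties as AnyP
open import Data.List.Relation.Unary.All using (All; []; _∷_)
import Data.List.Relation.Unary.All as AllM
import Data.List.Relation.Unary.All.Properties as AllP
import Data.List.Membership.DecPropositional as DecMembership
import Data.List.Relation.Unary.Unique.DecPropositional as DecUnique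
open import Data.List.Relation.Unary.AllPairs using ([]; _∷_)
open import Data.List.Relation.Unary.Unique.Propositional using (Unique)
import Data.List.Relation.Unary.Unique.Propositional.Properties as UniqueP
open import Data.List.Relation.Unary.Unique.DecPropositional.Properties using (deduplicate-!)
open import Data.List.Relation.Unary.Linked using (Linked; []; [-]; _∷_)
import Data.List.Relation.Unary.Linked as LinkedM
import Data.List.Relation.Unary.Linked.Properties as LinkedP
open import Data.Product using (Σ; _×_; _,_; proj₁; proj₂)
open import Data.Sum using (_⊎_; inj₁; inj₂) renaming (map to map⊎)
open import Relation.Nullary using (¬_; yes; no; Dec)
open import Relation.Nullary.Decidable using (⌊_⌋; isYes≗does; dec-true; dec-false; does-⇔)
open import Function.Bundles using (Equivalence; _⇔_; mk⇔)
open import Function.Construct.Identity using (⇔-id)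
open import Function.Construct.Composition using () renaming (equivalence to ⇔-trans)
open import Relation.Binary.PropositionalEquality
open import Relation.Binary.Definitions using (DecidableEquality)
open import Relation.Binary.Construct.Closure.ReflexiveTransitive using (Star; ε; _◅_; _◅◅_; gmap; reverse)

-- Boolean reflection.  Vertex sets and adjacency are Boolean-valued, so
-- the argument constantly moves between  b ≡ true  and propositions.

∧-elimˡ : ∀ {a b} → a ∧ b ≡ true → a ≡ true
∧-elimˡ = ∧-conicalˡ _ _

∧-elimʳ : ∀ {a b} → a ∧ b ≡ true → b ≡ true
∧-elimʳ = ∧-conicalʳ _ _

∧-intro : ∀ {a b} → a ≡ true → b ≡ true → a ∧ b ≡ true
∧-intro refl refl = refl

∨-elim : ∀ {a b} → a ∨ b ≡ true → a ≡ true ⊎ b ≡ true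
∨-elim {true}  _ = inj₁ refl
∨-elim {false} e = inj₂ e

∨-introˡ : ∀ {a b} → a ≡ true → a ∨ b ≡ true
∨-introˡ refl = refl

∨-introʳ : ∀ {a b} → b ≡ true → a ∨ b ≡ true
∨-introʳ {a} refl = ∨-zeroʳ a

true≢false : ∀ {a} → a ≡ true → a ≡ false → ⊥
true≢false refl ()

¬true⇒false : ∀ {a} → ¬ (a ≡ true) → a ≡ false
¬true⇒false {true}  n = ⊥-elim (n refl)
¬true⇒false {false} _ = refl

not-true : ∀ {a} → not a ≡ true → a ≡ false
not-true {false} _ = refl

bool-cases : ∀ b → b ≡ true ⊎ b ≡ false
bool-cases true  = inj₁ refl
bool-cases false = inj₂ refl

T⇒true : ∀ {a} → T a → a ≡ true
T⇒true = Equivalence.to T-≡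

true⇒T : ∀ {a} → a ≡ true → T a
true⇒T = Equivalence.from T-≡

T-∧-intro : ∀ {a b} → T a → T b → T (a ∧ b)
T-∧-intro {a} {b} p q = Equivalence.from (T-∧ {a} {b}) (p , q)

T-∧-elimˡ : ∀ {a b} → T (a ∧ b) → T a
T-∧-elimˡ {a} {b} p = proj₁ (Equivalence.to (T-∧ {a} {b}) p)

T-∧-elimʳ : ∀ {a b} → T (a ∧ b) → T b
T-∧-elimʳ {a} {b} p = proj₂ (Equivalence.to (T-∧ {a} {b}) p)

⌊⌋-true⇒ : ∀ {A : Set} (d : Dec A) → ⌊ d ⌋ ≡ true → A
⌊⌋-true⇒ (yes a) _ = a

⌊⌋-false⇒¬ : ∀ {A : Set} (d : Dec A) → ⌊ d ⌋ ≡ false → ¬ A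
⌊⌋-false⇒¬ (no n) _ = n

⌊⌋-true : ∀ {A : Set} (d : Dec A) → A → ⌊ d ⌋ ≡ true
⌊⌋-true d a = trans (isYes≗does d) (dec-true d a)

⌊⌋-false : ∀ {A : Set} (d : Dec A) → ¬ A → ⌊ d ⌋ ≡ false
⌊⌋-false d n = trans (isYes≗does d) (dec-false d n)

⌊⌋-cong : ∀ {A B : Set} (d : Dec A) (d' : Dec B) → (A → B) → (B → A) → ⌊ d ⌋ ≡ ⌊ d' ⌋
⌊⌋-cong d d' f g = trans (isYes≗does d) (trans (does-⇔ (mk⇔ f g) d d') (sym (isYes≗does d')))

decide : ∀ {A R : Set} → Dec A → (A → R) → (¬ A → R) → R
decide (yes a) f g = f a
decide (no n)  f g = g n

any-witness : ∀ {A : Set} (p : A → Bool) xs → any p xs ≡ true → Σ A λ x → x ∈ xs × p x ≡ true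
any-witness p (x ∷ xs) e with ∨-elim {p x} e
... | inj₁ q = x , here refl , q
... | inj₂ q with any-witness p xs q
... | y , m , r = y , there m , r

any-intro : ∀ {A : Set} (p : A → Bool) xs {x} → x ∈ xs → p x ≡ true → any p xs ≡ true
any-intro p (x ∷ xs) (here refl) q = ∨-introˡ q
any-intro p (x ∷ xs) (there m)   q = ∨-introʳ {p x} (any-intro p xs m q)

any-cong : ∀ {A : Set} (p q : A → Bool) xs → (∀ x → p x ≡ q x) → any p xs ≡ any q xs
any-cong p q []       e = refl
any-cong p q (x ∷ xs) e = cong₂ _∨_ (e x) (any-cong p q xs e)

pick : ∀ {A : Set} → (A → Bool) → List A → A → A
pick p []       d = d
pick p (x ∷ xs) d = if p x then x else pick p xs d

pick-sound : ∀ {A : Set} (p : A → Bool) xs d {x} → x ∈ xs → p x ≡ true → p (pick p xs d) ≡ true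
pick-sound p (y ∷ xs) d m q with p y in eq
... | true = eq
pick-sound p (y ∷ xs) d (here refl) q | false = ⊥-elim (true≢false q eq)
pick-sound p (y ∷ xs) d (there m)   q | false = pick-sound p xs d m q

-- Pigeonhole: a duplicate-free list contained in ys is no longer than ys.
-- (Used to force repetitions in long walks.)

remove : ∀ {A : Set} {x : A} (xs : List A) → x ∈ xs → List A
remove (y ∷ ys) (here _)  = ys
remove (y ∷ ys) (there p) = y ∷ remove ys p

remove-length : ∀ {A : Set} {x : A} (xs : List A) (p : x ∈ xs) → suc (length (remove xs p)) ≡ length xs
remove-length (y ∷ ys) (here _)  = refl
remove-length (y ∷ ys) (there p) = cong suc (remove-length ys p)

∈-remove : ∀ {A : Set} {x z : A} (xs : List A) (p : x ∈ xs) → z ∈ xs → ¬ z ≡ x → z ∈ remove xs p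
∈-remove (y ∷ ys) (here refl) (here refl) ne = ⊥-elim (ne refl)
∈-remove (y ∷ ys) (here refl) (there m)   ne = m
∈-remove (y ∷ ys) (there p)   (here refl) ne = here refl
∈-remove (y ∷ ys) (there p)   (there m)   ne = there (∈-remove ys p m ne)

unique-length-≤ : ∀ {A : Set} (xs ys : List A) → Unique xs → (∀ {z} → z ∈ xs → z ∈ ys) → length xs ≤ length ys
unique-length-≤ []       ys u        s = z≤n
unique-length-≤ (x ∷ xs) ys (a ∷ u) s =
  subst (suc (length xs) ≤_) (remove-length ys p) (s≤s (unique-length-≤ xs (remove ys p) u sub))
  where
  p = s (here refl)
  sub : ∀ {z} → z ∈ xs → z ∈ remove ys p
  sub m = ∈-remove ys p (s (there m)) (λ e → All¬⇒¬Any a (subst (_∈ xs) e m))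

module Enumeration (W : FinSet) where
  distinct : List (Carrier W)
  distinct = deduplicate (_≟_ W) (elems W)

  distinct-unique : Unique distinct
  distinct-unique = deduplicate-! (_≟_ W) (elems W)

  distinct-complete : ∀ x → x ∈ distinct
  distinct-complete x = AnyP.deduplicate⁺ (_≟_ W) (λ { refl q → q }) (complete W x)

  card : ℕ
  card = length distinct

  index-lookup : ∀ (xs : List (Carrier W)) → Unique xs → ∀ i (p : lookup xs i ∈ xs) → index p ≡ i
  index-lookup (y ∷ ys) u       fz     (here refl) = refl
  index-lookup (y ∷ ys) (a ∷ u) fz     (there p)   = ⊥-elim (All¬⇒¬Any a p)
  index-lookup (y ∷ ys) (a ∷ u) (fs i) (here e)    = ⊥-elim (All¬⇒¬Any a (subst (_∈ ys) e (∈-lookup i)))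
  index-lookup (y ∷ ys) (a ∷ u) (fs i) (there p)   = cong fs (index-lookup ys u i p)

  enumeration : Bij W (FinS card)
  enumeration = record
    { to = λ x → index (distinct-complete x)
    ; from = lookup distinct
    ; from∘to = λ x → sym (AnyP.lookup-index (distinct-complete x))
    ; to∘from = λ i → index-lookup distinct distinct-unique i (distinct-complete (lookup distinct i)) }

inverse : ∀ {U V} → Bij U V → Bij V U
inverse σ = record { to = from σ ; from = to σ ; from∘to = to∘from σ ; to∘from = from∘to σ }

VertexSet : FinSet → Set
VertexSet U = Carrier U → Bool

induced : ∀ {U} (G : Graph U) (S : VertexSet U) → Graph (Sub U S)
induced G S = record
  { adj = λ x y → adj G (proj₁ x) (proj₁ y)
  ; adj-sym = λ x y → adj-sym G (proj₁ x) (proj₁ y)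
  ; adj-irrefl = λ x → adj-irrefl G (proj₁ x) }

member : ∀ {U} {S : VertexSet U} x → S x ≡ true → Carrier (Sub U S)
member x e = x , true⇒T e

without : ∀ {U} → VertexSet U → Carrier U → VertexSet U
without {U} S x y = S y ∧ not ⌊ (U ≟ y) x ⌋

agree-at : ∀ {U} {S₁ S₂ : VertexSet U} x → (∀ y → ¬ y ≡ x → S₁ y ≡ S₂ y) → S₁ x ≡ S₂ x →
           ∀ y → S₁ y ≡ S₂ y
agree-at {U} {S₁} {S₂} x off at y = decide ((U ≟ y) x) (λ e → subst (λ z → S₁ z ≡ S₂ z) (sym e) at) (off y)

without-agree : ∀ {U} {S₁ S₂ : VertexSet U} x → (∀ y → ¬ y ≡ x → S₁ y ≡ S₂ y) → S₂ x ≡ false →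
                ∀ y → without {U} S₁ x y ≡ S₂ y
without-agree {U} {S₁} {S₂} x off gone y = decide ((U ≟ y) x) at-x away
  where
  at-x : y ≡ x → without {U} S₁ x y ≡ S₂ y
  at-x refl = trans (cong (λ b → S₁ y ∧ not b) (⌊⌋-true ((U ≟ y) y) refl)) (trans (∧-zeroʳ (S₁ y)) (sym gone))
  away : ¬ y ≡ x → without {U} S₁ x y ≡ S₂ y
  away ne = trans (cong (λ b → S₁ y ∧ not b) (⌊⌋-false ((U ≟ y) x) ne)) (trans (∧-identityʳ (S₁ y)) (off y ne))

module InducedΦ (Φ : GraphSubspecies) {U : FinSet} (G : Graph U) where

  IsInduced : VertexSet U → Set
  IsInduced S = Is Φ (Sub U S) (induced G S)

  IsInduced-cong : ∀ {S S'} → (∀ x → S x ≡ S' x) → IsInduced S ⇔ IsInduced S'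
  IsInduced-cong {S} {S'} e = mk⇔ (transport S S' e) (transport S' S (λ x → sym (e x)))
    where
    transport : ∀ S S' → (∀ x → S x ≡ S' x) → IsInduced S → IsInduced S'
    transport S S' e i = ext-closed Φ (λ _ _ → refl) (relabel-closed Φ β (induced G S) i)
      where
      β : Bij (Sub U S) (Sub U S')
      β = record
        { to = λ x → proj₁ x , subst T (e (proj₁ x)) (proj₂ x)
        ; from = λ x → proj₁ x , subst T (sym (e (proj₁ x))) (proj₂ x)
        ; from∘to = λ x → subEq {U} {S} refl
        ; to∘from = λ x → subEq {U} {S'} refl }

  IsInduced-whole : Is Φ U G ⇔ IsInduced (λ _ → true)
  IsInduced-whole = mk⇔
    (λ i → ext-closed Φ (λ _ _ → refl) (relabel-closed Φ β G i))
    (λ i → ext-closed Φ (λ _ _ → refl) (relabel-closed Φ (inverse β) (induced G (λ _ → true)) i))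
    where
    β : Bij U (Sub U (λ _ → true))
    β = record { to = λ x → x , tt ; from = proj₁ ; from∘to = λ _ → refl ; to∘from = λ _ → refl }

  -- Deleting an endpoint x of G[S] does not change Φ-membership: G[S] - x
  -- is, up to relabeling, G[without S x].
  IsInduced-delete : EndpointClosed Φ → ∀ S x (sx : S x ≡ true) →
                     Endpoint (induced G S) (member {U} {S} x sx) →
                     IsInduced S ⇔ IsInduced (without {U} S x)
  IsInduced-delete ec S x sx ep = mk⇔
    (λ i → ext-closed Φ (λ _ _ → refl)
             (relabel-closed Φ β (induced G S ─G v) (proj₁ (ec (Sub U S) (induced G S) v ep) i)))
    (λ i → proj₂ (ec (Sub U S) (induced G S) v ep)
             (ext-closed Φ (λ _ _ → refl) (relabel-closed Φ (inverse β) (induced G (without {U} S x)) i)))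
    where
    v : Carrier (Sub U S)
    v = member {U} {S} x sx

    ≟-Sub : ∀ (a b : Carrier (Sub U S)) → ⌊ (Sub U S ≟ a) b ⌋ ≡ ⌊ (U ≟ proj₁ a) (proj₁ b) ⌋
    ≟-Sub a b = ⌊⌋-cong ((Sub U S ≟ a) b) ((U ≟ proj₁ a) (proj₁ b)) (cong proj₁) (subEq {U} {S})

    β : Bij (Sub U S ─ v) (Sub U (without {U} S x))
    β = record
      { to = λ a → proj₁ (proj₁ a) , T-∧-intro (proj₂ (proj₁ a))
                      (subst (λ b → T (not b)) (≟-Sub (proj₁ a) v) (proj₂ a))
      ; from = λ a → (proj₁ a , T-∧-elimˡ {S (proj₁ a)} (proj₂ a))
                   , subst (λ b → T (not b)) (sym (≟-Sub (proj₁ a , T-∧-elimˡ {S (proj₁ a)} (proj₂ a)) v))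
                           (T-∧-elimʳ {S (proj₁ a)} (proj₂ a))
      ; from∘to = λ a → subEq {Sub U S} {λ u → not ⌊ (Sub U S ≟ u) v ⌋} (subEq {U} {S} refl)
      ; to∘from = λ a → subEq {U} {without {U} S x} refl }

count : ∀ {A : Set} → (A → Bool) → List A → ℕ
count p []       = 0
count p (x ∷ xs) = if p x then suc (count p xs) else count p xs

count-≤-length : ∀ {A : Set} (p : A → Bool) xs → count p xs ≤ length xs
count-≤-length p [] = z≤n
count-≤-length p (x ∷ xs) with p x
... | true  = s≤s (count-≤-length p xs)
... | false = m≤n⇒m≤1+n (count-≤-length p xs)

count-mono : ∀ {A : Set} (p q : A → Bool) xs → (∀ x → p x ≡ true → q x ≡ true) → count p xs ≤ count q xs
count-mono p q [] h = z≤n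
count-mono p q (x ∷ xs) h with p x in e1 | q x in e2
... | true  | true  = s≤s (count-mono p q xs h)
... | true  | false = ⊥-elim (true≢false (h x e1) e2)
... | false | true  = m≤n⇒m≤1+n (count-mono p q xs h)
... | false | false = count-mono p q xs h

count-< : ∀ {A : Set} (p q : A → Bool) xs → (∀ x → p x ≡ true → q x ≡ true) →
          ∀ {x} → x ∈ xs → q x ≡ true → p x ≡ false → count p xs < count q xs
count-< p q (y ∷ xs) h (here refl) qx px rewrite qx | px = s≤s (count-mono p q xs h)
count-< p q (y ∷ xs) h (there m) qx px with p y in e1 | q y in e2
... | true  | true  = s≤s (count-< p q xs h m qx px)
... | true  | false = ⊥-elim (true≢false (h y e1) e2)
... | false | true  = m≤n⇒m≤1+n (count-< p q xs h m qx px)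
... | false | false = count-< p q xs h m qx px

count-zero : ∀ {A : Set} (p : A → Bool) xs → count p xs ≡ 0 → ∀ {x} → x ∈ xs → p x ≡ false
count-zero p (y ∷ xs) c m with p y in e
count-zero p (y ∷ xs) () m          | true
count-zero p (y ∷ xs) c (here refl) | false = e
count-zero p (y ∷ xs) c (there m)   | false = count-zero p xs c m

-- Pruning.  alive 0 = V(G) and alive (t+1) keeps the vertices of alive t
-- having at least two distinct neighbours in alive t: every round deletes
-- all current endpoints (and isolated vertices).

module Pruning {U : FinSet} (G : Graph U) where
  E : List (Carrier U)
  E = elems U

  n : ℕ
  n = length E

  Adj-sym : ∀ {x y} → Adj G x y → Adj G y x
  Adj-sym {x} {y} e = trans (adj-sym G y x) e

  nbrIn : VertexSet U → Carrier U → Carrier U → Bool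
  nbrIn S v a = adj G v a ∧ S a

  twoNbrsIn : VertexSet U → Carrier U → Bool
  twoNbrsIn S v = any (λ a → nbrIn S v a ∧ any (λ b → nbrIn S v b ∧ not ⌊ (U ≟ a) b ⌋) E) E

  twoNbrsIn-intro : ∀ S v a b → nbrIn S v a ≡ true → nbrIn S v b ≡ true → ¬ a ≡ b → twoNbrsIn S v ≡ true
  twoNbrsIn-intro S v a b na nb ne = any-intro _ E (complete U a)
    (∧-intro na (any-intro _ E (complete U b) (∧-intro nb (cong not (⌊⌋-false ((U ≟ a) b) ne)))))

  twoNbrsIn-witness : ∀ S v → twoNbrsIn S v ≡ true → Σ (Carrier U) λ a → Σ (Carrier U) λ b →
                      nbrIn S v a ≡ true × nbrIn S v b ≡ true × ¬ a ≡ b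
  twoNbrsIn-witness S v h with any-witness _ E h
  ... | a , _ , q with any-witness _ E (∧-elimʳ {nbrIn S v a} q)
  ... | b , _ , r = a , b , ∧-elimˡ q , ∧-elimˡ r , ⌊⌋-false⇒¬ ((U ≟ a) b) (not-true (∧-elimʳ {nbrIn S v b} r))

  uniqueNbrIn : ∀ S v a b → twoNbrsIn S v ≡ false → nbrIn S v a ≡ true → nbrIn S v b ≡ true → a ≡ b
  uniqueNbrIn S v a b h na nb with (U ≟ a) b
  ... | yes e  = e
  ... | no ne = ⊥-elim (true≢false (twoNbrsIn-intro S v a b na nb ne) h)

  twoNbrsIn-cong : ∀ S S' → (∀ x → S x ≡ S' x) → ∀ v → twoNbrsIn S v ≡ twoNbrsIn S' v
  twoNbrsIn-cong S S' e v = any-cong _ _ E λ a → cong₂ _∧_ (cong (adj G v a ∧_) (e a))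
    (any-cong _ _ E λ b → cong₂ _∧_ (cong (adj G v b ∧_) (e b)) refl)

  alive : ℕ → VertexSet U
  alive zero    v = true
  alive (suc t) v = alive t v ∧ twoNbrsIn (alive t) v

  alive-shrinks : ∀ t v → alive (suc t) v ≡ true → alive t v ≡ true
  alive-shrinks t v e = ∧-elimˡ e

  alive-antitone : ∀ {t t'} v → t ≤ t' → alive t' v ≡ true → alive t v ≡ true
  alive-antitone {t} {t'} v le e with m≤n⇒m<n∨m≡n le
  ... | inj₂ refl = e
  alive-antitone {t} {suc t'} v le e | inj₁ (s≤s lt) = alive-antitone v lt (alive-shrinks t' v e)

  survivor-twoNbrs : ∀ t v → alive (suc t) v ≡ true → twoNbrsIn (alive t) v ≡ true
  survivor-twoNbrs t v e = ∧-elimʳ {alive t v} e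

  pruned-fewNbrs : ∀ t v → alive t v ≡ true → alive (suc t) v ≡ false → twoNbrsIn (alive t) v ≡ false
  pruned-fewNbrs t v a f = ¬true⇒false (λ h → true≢false (∧-intro a h) f)

  Stable : ℕ → Set
  Stable t = ∀ v → alive (suc t) v ≡ alive t v

  stable-suc : ∀ t → Stable t → Stable (suc t)
  stable-suc t s v = ∧-absorb (alive (suc t) v) (twoNbrsIn (alive (suc t)) v)
    (λ e → trans (twoNbrsIn-cong (alive (suc t)) (alive t) s v) (survivor-twoNbrs t v e))
    where
    ∧-absorb : ∀ a b → (a ≡ true → b ≡ true) → a ∧ b ≡ a
    ∧-absorb true  b h = h refl
    ∧-absorb false b h = refl

  stable-+ : ∀ t m → Stable t → Stable (m + t)
  stable-+ t zero    s = s
  stable-+ t (suc m) s = stable-suc (m + t) (stable-+ t m s)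

  aliveCount : ℕ → ℕ
  aliveCount t = count (alive t) E

  stable-or-shrinks : ∀ t → Stable t ⊎ aliveCount (suc t) < aliveCount t
  stable-or-shrinks t with any (λ v → alive t v ∧ not (alive (suc t) v)) E in e
  ... | true with any-witness _ E e
  ...   | v , m , q = inj₂ (count-< (alive (suc t)) (alive t) E (alive-shrinks t) m (∧-elimˡ q)
                               (not-true (∧-elimʳ {alive t v} q)))
  stable-or-shrinks t | false = inj₁ λ v → unchanged v (alive (suc t) v) refl (alive t v) refl
    where
    unchanged : ∀ v a → alive (suc t) v ≡ a → ∀ b → alive t v ≡ b → a ≡ b
    unchanged v true  ea true  eb = refl
    unchanged v true  ea false eb = ⊥-elim (true≢false (alive-shrinks t v ea) eb)
    unchanged v false ea true  eb =
      ⊥-elim (true≢false (any-intro _ E (complete U v) (∧-intro eb (cong not ea))) e)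
    unchanged v false ea false eb = refl

  stable-by : ∀ t → (Σ ℕ λ t' → t' ≤ t × Stable t') ⊎ (aliveCount t + t ≤ n)
  stable-by zero = inj₂ (subst (_≤ n) (sym (+-identityʳ (aliveCount 0))) (count-≤-length (alive 0) E))
  stable-by (suc t) with stable-by t
  ... | inj₁ (t' , le , s) = inj₁ (t' , m≤n⇒m≤1+n le , s)
  ... | inj₂ h with stable-or-shrinks t
  ...   | inj₁ s  = inj₁ (t , n≤1+n t , s)
  ...   | inj₂ lt = inj₂ (≤-trans (≤-reflexive (+-suc (aliveCount (suc t)) t)) (≤-trans (+-monoˡ-≤ t lt) h))

  stable-n : Stable n
  stable-n with stable-by n
  ... | inj₁ (t' , le , s) = subst Stable (m∸n+n≡m le) (stable-+ t' (n ∸ t') s)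
  ... | inj₂ h = λ v → trans (dead (suc n) (n≤1+n n) v) (sym (dead n ≤-refl v))
    where
    nobody : aliveCount n ≡ 0
    nobody = n≤0⇒n≡0 (+-cancelʳ-≤ n (aliveCount n) 0 h)
    dead : ∀ t → n ≤ t → ∀ v → alive t v ≡ false
    dead t le v = ¬true⇒false λ a →
      true≢false (alive-antitone v le a) (count-zero (alive n) E nobody (complete U v))

  core : VertexSet U
  core = alive n

  alive-beyond-n : ∀ m v → alive (m + n) v ≡ alive n v
  alive-beyond-n zero    v = refl
  alive-beyond-n (suc m) v = trans (stable-+ n m stable-n v) (alive-beyond-n m v)

  core-alive : ∀ v → core v ≡ true → ∀ t → alive t v ≡ true
  core-alive v c t with ≤-total t n
  ... | inj₁ le = alive-antitone v le c
  ... | inj₂ le = subst (λ s → alive s v ≡ true) (m∸n+n≡m le) (trans (alive-beyond-n (t ∸ n) v) c)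

  core-twoNbrs : ∀ v → core v ≡ true → twoNbrsIn core v ≡ true
  core-twoNbrs v c = survivor-twoNbrs n v (core-alive v c (suc n))

  lastAliveUpTo : Carrier U → ℕ → ℕ
  lastAliveUpTo v zero    = zero
  lastAliveUpTo v (suc t) = if alive (suc t) v then suc t else lastAliveUpTo v t

  lastAliveUpTo-alive : ∀ v t → alive (lastAliveUpTo v t) v ≡ true
  lastAliveUpTo-alive v zero = refl
  lastAliveUpTo-alive v (suc t) with alive (suc t) v in e
  ... | true  = e
  ... | false = lastAliveUpTo-alive v t

  lastAliveUpTo-≤ : ∀ v t → lastAliveUpTo v t ≤ t
  lastAliveUpTo-≤ v zero = z≤n
  lastAliveUpTo-≤ v (suc t) with alive (suc t) v
  ... | true  = ≤-refl
  ... | false = m≤n⇒m≤1+n (lastAliveUpTo-≤ v t)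

  lastAliveUpTo-max : ∀ v t t' → t' ≤ t → alive t' v ≡ true → t' ≤ lastAliveUpTo v t
  lastAliveUpTo-max v zero .zero z≤n a = z≤n
  lastAliveUpTo-max v (suc t) t' le a with alive (suc t) v in e
  ... | true = le
  ... | false with m≤n⇒m<n∨m≡n le
  ...   | inj₁ (s≤s lt) = lastAliveUpTo-max v t t' lt a
  ...   | inj₂ refl     = ⊥-elim (true≢false a e)

  lastAlive : Carrier U → ℕ
  lastAlive v = lastAliveUpTo v n

  alive-lastAlive : ∀ v → alive (lastAlive v) v ≡ true
  alive-lastAlive v = lastAliveUpTo-alive v n

  lastAlive-≤ : ∀ v → lastAlive v ≤ n
  lastAlive-≤ v = lastAliveUpTo-≤ v n

  lastAlive-max : ∀ v t → t ≤ n → alive t v ≡ true → t ≤ lastAlive v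
  lastAlive-max v t = lastAliveUpTo-max v n t

  alive-before-lastAlive : ∀ v t → t ≤ lastAlive v → alive t v ≡ true
  alive-before-lastAlive v t le = alive-antitone v le (alive-lastAlive v)

  noncore-lastAlive-< : ∀ v → core v ≡ false → lastAlive v < n
  noncore-lastAlive-< v c with m≤n⇒m<n∨m≡n (lastAlive-≤ v)
  ... | inj₁ lt = lt
  ... | inj₂ e  = ⊥-elim (true≢false (subst (λ s → alive s v ≡ true) e (alive-lastAlive v)) c)

  noncore-pruned : ∀ v → core v ≡ false → alive (suc (lastAlive v)) v ≡ false
  noncore-pruned v c =
    ¬true⇒false λ a → <-irrefl refl (lastAlive-max v (suc (lastAlive v)) (noncore-lastAlive-< v c) a)

  -- walks of G that stay inside S (after their first vertex)
  StepIn : VertexSet U → Carrier U → Carrier U → Set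
  StepIn S x y = Adj G x y × S y ≡ true

  WalkIn : VertexSet U → Carrier U → Carrier U → Set
  WalkIn S = Star (StepIn S)

  -- A walk in alive t between survivors of round t+1 yields one in alive
  -- (t+1): a pruned inner vertex has a single alive neighbour, so the walk
  -- just steps back there and the detour can be cut out.
  shortcut : ∀ t {x y} → WalkIn (alive t) x y → alive (suc t) x ≡ true → alive (suc t) y ≡ true →
             WalkIn (alive (suc t)) x y
  shortcut t ε _ _ = ε
  shortcut t {x} (_◅_ {j = x₁} (e , a₁) rest) ax ay with bool-cases (alive (suc t) x₁)
  ... | inj₁ b₁ = (e , b₁) ◅ shortcut t rest b₁ ay
  shortcut t (_◅_ (e , a₁) ε) ax ay | inj₂ b₁ = ⊥-elim (true≢false ay b₁)
  shortcut t {x} (_◅_ {j = x₁} (e , a₁) (_◅_ {j = x₂} (e₂ , a₂) rest)) ax ay | inj₂ b₁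
    with uniqueNbrIn (alive t) x₁ x₂ x (pruned-fewNbrs t x₁ a₁ b₁) (∧-intro e₂ a₂)
                     (∧-intro (Adj-sym e) (alive-shrinks t x ax))
  ... | refl = shortcut t rest ax ay

  alive-connected : Connected G → ∀ t x y → alive t x ≡ true → alive t y ≡ true → WalkIn (alive t) x y
  alive-connected (_ , c) zero    x y _  _  = gmap (λ z → z) (λ e → e , refl) (c x y)
  alive-connected cg      (suc t) x y ax ay =
    shortcut t (alive-connected cg t x y (alive-shrinks t x ax) (alive-shrinks t y ay)) ax ay

  trapped : ∀ t x w → alive t x ≡ true → alive t w ≡ true → Adj G x w →
            twoNbrsIn (alive t) x ≡ false → twoNbrsIn (alive t) w ≡ false →
            ∀ {u y} → (u ≡ x ⊎ u ≡ w) → WalkIn (alive t) u y → y ≡ x ⊎ y ≡ w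
  trapped t x w ax aw xw hx hw h ε = h
  trapped t x w ax aw xw hx hw (inj₁ refl) ((e , a) ◅ p) =
    trapped t x w ax aw xw hx hw (inj₂ (uniqueNbrIn (alive t) x _ w hx (∧-intro e a) (∧-intro xw aw))) p
  trapped t x w ax aw xw hx hw (inj₂ refl) ((e , a) ◅ p) =
    trapped t x w ax aw xw hx hw (inj₁ (uniqueNbrIn (alive t) w _ x hw (∧-intro e a) (∧-intro (Adj-sym xw) ax))) p

  pruned-survivorNbr : Connected G → ∀ t x y → alive t x ≡ true → alive (suc t) x ≡ false →
                       alive (suc t) y ≡ true → Σ (Carrier U) λ w → Adj G x w × alive (suc t) w ≡ true
  pruned-survivorNbr cg t x y ax bx by = first (alive-connected cg t x y ax (alive-shrinks t y by))
    where
    first : WalkIn (alive t) x y → Σ (Carrier U) λ w → Adj G x w × alive (suc t) w ≡ true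
    first ε = ⊥-elim (true≢false by bx)
    first (_◅_ {j = w} (e , a) rest) with bool-cases (alive (suc t) w)
    ... | inj₁ bw = w , e , bw
    ... | inj₂ bw with trapped t x w ax a e (pruned-fewNbrs t x ax bx) (pruned-fewNbrs t w a bw) (inj₂ refl) rest
    ...   | inj₁ refl = ⊥-elim (true≢false by bx)
    ...   | inj₂ refl = ⊥-elim (true≢false by bw)

module _ {U : FinSet} (G H : Graph U) (e : ∀ x y → adj G x y ≡ adj H x y) where
  private
    module PG = Pruning G
    module PH = Pruning H

  alive-cong : ∀ t v → PG.alive t v ≡ PH.alive t v
  alive-cong zero v = refl
  alive-cong (suc t) v = cong₂ _∧_ (alive-cong t v)
    (trans (PG.twoNbrsIn-cong (PG.alive t) (PH.alive t) (alive-cong t) v)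
      (any-cong _ _ (elems U) λ a → cong₂ _∧_ (cong (_∧ PH.alive t a) (e v a))
        (any-cong _ _ (elems U) λ b → cong (λ z → (z ∧ PH.alive t b) ∧ not ⌊ (U ≟ a) b ⌋) (e v b))))

-- If S' ⊆ S and every vertex of S outside
-- S' has exactly one neighbour in S, lying in S', then G[S] is obtained
-- from G[S'] by repeatedly creating endpoints, so by closure under
-- creating and deleting endpoints, G[S] is a Φ-graph iff G[S'] is.

module PendantDeletion (Φ : GraphSubspecies) (ec : EndpointClosed Φ) {U : FinSet} (G : Graph U) where
  open InducedΦ Φ G public

  HangsOff : VertexSet U → VertexSet U → Carrier U → Set
  HangsOff S S' x = Σ (Carrier U) λ w → Adj G x w × S' w ≡ true × (∀ y → Adj G x y → S y ≡ true → y ≡ w)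

  Pendants : VertexSet U → VertexSet U → Set
  Pendants S S' = (∀ y → S' y ≡ true → S y ≡ true) × (∀ x → S x ≡ true → S' x ≡ false → HangsOff S S' x)

  _∈ᵇ_ : Carrier U → List (Carrier U) → Bool
  y ∈ᵇ L = any (λ z → ⌊ (U ≟ y) z ⌋) L

  module _ {S S' : VertexSet U} (pendants : Pendants S S') where
    between : List (Carrier U) → VertexSet U
    between L y = S' y ∨ (S y ∧ y ∈ᵇ L)

    between-⊆ : ∀ L y → between L y ≡ true → S y ≡ true
    between-⊆ L y e with ∨-elim {S' y} e
    ... | inj₁ s' = proj₁ pendants y s'
    ... | inj₂ s  = ∧-elimˡ s

    between-off : ∀ x L y → ¬ y ≡ x → between (x ∷ L) y ≡ between L y
    between-off x L y ne = cong (λ b → S' y ∨ (S y ∧ (b ∨ y ∈ᵇ L))) (⌊⌋-false ((U ≟ y) x) ne)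

    between-at : ∀ x L → S x ≡ false ⊎ S' x ≡ true ⊎ x ∈ᵇ L ≡ true → between (x ∷ L) x ≡ between L x
    between-at x L (inj₁ s)        rewrite s  = refl
    between-at x L (inj₂ (inj₁ s')) rewrite s' = refl
    between-at x L (inj₂ (inj₂ l)) rewrite l | ⌊⌋-true ((U ≟ x) x) refl = refl

    between-step : ∀ x L → IsInduced (between (x ∷ L)) ⇔ IsInduced (between L)
    between-step x L with bool-cases (S x) | bool-cases (S' x) | bool-cases (x ∈ᵇ L)
    ... | inj₂ s | _       | _ = IsInduced-cong (agree-at {U} x (between-off x L) (between-at x L (inj₁ s)))
    ... | inj₁ _ | inj₁ s' | _ = IsInduced-cong (agree-at {U} x (between-off x L) (between-at x L (inj₂ (inj₁ s'))))
    ... | inj₁ _ | inj₂ _ | inj₁ l = IsInduced-cong (agree-at {U} x (between-off x L) (between-at x L (inj₂ (inj₂ l))))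
    ... | inj₁ s | inj₂ s' | inj₂ l =
      ⇔-trans (IsInduced-delete ec (between (x ∷ L)) x listed endpoint)
              (IsInduced-cong (without-agree {U} x (between-off x L) gone))
      where
      listed : between (x ∷ L) x ≡ true
      listed = ∨-introʳ {S' x} (∧-intro s (∨-introˡ (⌊⌋-true ((U ≟ x) x) refl)))
      gone : between L x ≡ false
      gone = cong₂ _∨_ s' (cong₂ _∧_ s l)
      hang = proj₂ pendants x s s'
      endpoint : Endpoint (induced G (between (x ∷ L))) (member {U} {between (x ∷ L)} x listed)
      endpoint = member {U} {between (x ∷ L)} (proj₁ hang) (∨-introˡ (proj₁ (proj₂ (proj₂ hang))))
               , proj₁ (proj₂ hang)
               , λ y e → subEq {U} {between (x ∷ L)}
                   (proj₂ (proj₂ (proj₂ hang)) (proj₁ y) e (between-⊆ (x ∷ L) (proj₁ y) (T⇒true (proj₂ y))))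

    between-listed : ∀ L → IsInduced (between L) ⇔ IsInduced (between [])
    between-listed []      = ⇔-id _
    between-listed (x ∷ L) = ⇔-trans (between-step x L) (between-listed L)

    delete-pendants : IsInduced S ⇔ IsInduced S'
    delete-pendants =
      ⇔-trans (IsInduced-cong all-listed) (⇔-trans (between-listed E) (IsInduced-cong none-listed))
      where
      E = elems U
      all-listed : ∀ y → S y ≡ between E y
      all-listed y with bool-cases (S' y)
      ... | inj₁ s' rewrite s' = proj₁ pendants y s'
      ... | inj₂ s' rewrite s' | any-intro (λ z → ⌊ (U ≟ y) z ⌋) E (complete U y) (⌊⌋-true ((U ≟ y) y) refl)
        = sym (∧-identityʳ (S y))
      none-listed : ∀ y → between [] y ≡ S' y
      none-listed y = trans (cong (S' y ∨_) (∧-zeroʳ (S y))) (∨-identityʳ (S' y))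

-- In a connected graph one
-- round of pruning deletes pendant vertices (as long as something
-- survives), so G is a Φ-graph iff its core is; if the core is empty
-- the last nonempty round is a vertex or an edge, so G is a Φ-graph iff
-- the one-vertex graph is.

module PruningΦ (Φ : GraphSubspecies) (ec : EndpointClosed Φ) {U : FinSet} (G : Graph U) (cg : Connected G) where
  open Pruning G
  open PendantDeletion Φ ec G public

  round-pendants : ∀ t y → alive (suc t) y ≡ true → Pendants (alive t) (alive (suc t))
  round-pendants t y ay = alive-shrinks t , hang
    where
    hang : ∀ x → alive t x ≡ true → alive (suc t) x ≡ false → HangsOff (alive t) (alive (suc t)) x
    hang x ax bx with pruned-survivorNbr cg t x y ax bx ay
    ... | w , xw , bw = w , xw , bw , λ z xz az →
      uniqueNbrIn (alive t) x z w (pruned-fewNbrs t x ax bx) (∧-intro xz az) (∧-intro xw (alive-shrinks t w bw))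

  alive-invariant : ∀ t y → alive t y ≡ true → Is Φ U G ⇔ IsInduced (alive t)
  alive-invariant zero    y a = IsInduced-whole
  alive-invariant (suc t) y a =
    ⇔-trans (alive-invariant t y (alive-shrinks t y a)) (delete-pendants (round-pendants t y a))

  core-invariant : ∀ y → core y ≡ true → Is Φ U G ⇔ IsInduced core
  core-invariant y c = alive-invariant n y c

  single : Carrier U → VertexSet U
  single z y = ⌊ (U ≟ y) z ⌋

  IsInduced-single : ∀ z → IsInduced (single z) ⇔ Is Φ (FinS 1) oneVertexGraph
  IsInduced-single z = mk⇔
    (λ i → ext-closed Φ (λ _ _ → adj-irrefl G z) (relabel-closed Φ β (induced G (single z)) i))
    (λ i → ext-closed Φ (λ a b → edgeless-single a b) (relabel-closed Φ (inverse β) oneVertexGraph i))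
    where
    it : Carrier (Sub U (single z))
    it = z , true⇒T (⌊⌋-true ((U ≟ z) z) refl)
    is-z : (a : Carrier (Sub U (single z))) → proj₁ a ≡ z
    is-z a = ⌊⌋-true⇒ ((U ≟ proj₁ a) z) (T⇒true (proj₂ a))
    β : Bij (Sub U (single z)) (FinS 1)
    β = record { to = λ _ → fz ; from = λ _ → it
               ; from∘to = λ a → subEq {U} {single z} (sym (is-z a))
               ; to∘from = λ { fz → refl } }
    edgeless-single : ∀ a b → false ≡ adj G (proj₁ a) (proj₁ b)
    edgeless-single a b rewrite is-z a | is-z b = sym (adj-irrefl G z)

  LastNonempty : ℕ → Set
  LastNonempty t = (Σ (Carrier U) λ y → alive t y ≡ true) × (∀ v → alive (suc t) v ≡ false)

  private
    search : ∀ m → (Σ ℕ LastNonempty) ⊎ (Σ (Carrier U) λ y → alive m y ≡ true)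
    search zero = inj₂ (proj₁ cg , refl)
    search (suc m) with search m
    ... | inj₁ found = inj₁ found
    ... | inj₂ (y , a) with bool-cases (any (alive (suc m)) E)
    ...   | inj₁ q = let (z , _ , b) = any-witness (alive (suc m)) E q in inj₂ (z , b)
    ...   | inj₂ q = inj₁ (m , (y , a) , λ v →
                       ¬true⇒false (λ h → true≢false (any-intro (alive (suc m)) E (complete U v) h) q))

  last-nonempty-round : (∀ v → core v ≡ false) → Σ ℕ LastNonempty
  last-nonempty-round empty with search n
  ... | inj₁ found   = found
  ... | inj₂ (y , a) = ⊥-elim (true≢false a (empty y))

  -- The last nonempty round is a single vertex or a single edge (whose
  -- ends have at most one alive neighbour); either way it reduces to one
  -- vertex.
  last-round-single : ∀ t x → alive t x ≡ true → (∀ v → alive (suc t) v ≡ false) →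
                      Σ (Carrier U) λ z → IsInduced (alive t) ⇔ IsInduced (single z)
  last-round-single t x ax emp with bool-cases (any (nbrIn (alive t) x) E)
  ... | inj₂ lonely = x , IsInduced-cong only-x
    where
    only-x : ∀ y → alive t y ≡ single x y
    only-x y with bool-cases (alive t y)
    ... | inj₂ a rewrite a = sym (⌊⌋-false ((U ≟ y) x) (λ { refl → true≢false ax a }))
    ... | inj₁ a rewrite a = sym (⌊⌋-true ((U ≟ y) x) (stays (alive-connected cg t x y ax a)))
      where
      stays : WalkIn (alive t) x y → y ≡ x
      stays ε = refl
      stays ((e , a') ◅ _) =
        ⊥-elim (true≢false (any-intro (nbrIn (alive t) x) E (complete U _) (∧-intro e a')) lonely)
  ... | inj₁ q with any-witness (nbrIn (alive t) x) E q
  ...   | w , _ , xw∧aw = w , delete-pendants (w-alive , hang)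
    where
    xw : Adj G x w
    xw = ∧-elimˡ xw∧aw
    aw : alive t w ≡ true
    aw = ∧-elimʳ {adj G x w} xw∧aw
    few : ∀ y → alive t y ≡ true → twoNbrsIn (alive t) y ≡ false
    few y a = pruned-fewNbrs t y a (emp y)
    w-alive : ∀ y → single w y ≡ true → alive t y ≡ true
    w-alive y e = subst (λ z → alive t z ≡ true) (sym (⌊⌋-true⇒ ((U ≟ y) w) e)) aw
    hang : ∀ y → alive t y ≡ true → single w y ≡ false → HangsOff (alive t) (single w) y
    hang y ay ny with trapped t x w ax aw xw (few x ax) (few w aw) (inj₁ refl) (alive-connected cg t x y ax ay)
    ... | inj₂ refl = ⊥-elim (true≢false (⌊⌋-true ((U ≟ w) w) refl) ny)
    ... | inj₁ refl = w , xw , ⌊⌋-true ((U ≟ w) w) refl , λ z xz az →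
                      uniqueNbrIn (alive t) x z w (few x ax) (∧-intro xz az) (∧-intro xw aw)

  tree-invariant : (∀ v → core v ≡ false) → Is Φ U G ⇔ Is Φ (FinS 1) oneVertexGraph
  tree-invariant empty with last-nonempty-round empty
  ... | t , (x , ax) , emp with last-round-single t x ax emp
  ...   | z , last = ⇔-trans (alive-invariant t x ax) (⇔-trans last (IsInduced-single z))

module _ {A : Set} where
  split-first : ∀ (_≟A_ : DecidableEquality A) {a : A} (l : List A) → a ∈ l →
                Σ (List A) λ ys → Σ (List A) λ zs → l ≡ ys ++ a ∷ zs × a ∉ ys
  split-first _≟A_ {a} (b ∷ l) m with a ≟A b
  ... | yes refl = [] , l , refl , (λ ())
  split-first _≟A_ {a} (b ∷ l) (here e)  | no ne = ⊥-elim (ne e)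
  split-first _≟A_ {a} (b ∷ l) (there m) | no ne with split-first _≟A_ l m
  ... | ys , zs , refl , nin = b ∷ ys , zs , refl , λ { (here e) → ne e ; (there q) → nin q }

  unique-prefix : ∀ (ys zs : List A) → Unique (ys ++ zs) → Unique ys
  unique-prefix []       zs u       = []
  unique-prefix (y ∷ ys) zs (a ∷ u) = AllP.++⁻ˡ ys a ∷ unique-prefix ys zs u

  unique-snoc : ∀ {x} (l : List A) → Unique l → x ∉ l → Unique (l ++ x ∷ [])
  unique-snoc l u nin = UniqueP.++⁺ u ([] ∷ []) λ { (m , here refl) → nin m }

  module _ {R : A → A → Set} where
    linked-prefix : ∀ (l m : List A) → Linked R (l ++ m) → Linked R l
    linked-prefix []          m _        = []
    linked-prefix (x ∷ [])    m _        = [-]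
    linked-prefix (x ∷ y ∷ l) m (r ∷ lk) = r ∷ linked-prefix (y ∷ l) m lk

    linked-last : ∀ (a : A) (l : List A) {x} → Linked R (a ∷ l ++ x ∷ []) → Σ A λ z → z ∈ a ∷ l × R z x
    linked-last a []      (r ∷ _)  = a , here refl , r
    linked-last a (b ∷ l) (_ ∷ lk) with linked-last b l lk
    ... | z , m , r = z , there m , r

    linked-snoc : ∀ (c : A) (l : List A) {a b} → Linked R (c ∷ l ++ a ∷ []) → R a b →
                  Linked R (c ∷ (l ++ a ∷ []) ++ b ∷ [])
    linked-snoc c []      (r ∷ [-]) r' = r ∷ r' ∷ [-]
    linked-snoc c (d ∷ l) (r ∷ lk)  r' = r ∷ linked-snoc d l lk r'

  NonBacktracking : List A → Set
  NonBacktracking (a ∷ b ∷ c ∷ l) = ¬ a ≡ c × NonBacktracking (b ∷ c ∷ l)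
  NonBacktracking _ = ⊤

  NonBacktracking-tail : ∀ {x : A} l → NonBacktracking (x ∷ l) → NonBacktracking l
  NonBacktracking-tail []          _        = tt
  NonBacktracking-tail (b ∷ [])    _        = tt
  NonBacktracking-tail (b ∷ c ∷ l) (_ , nb) = nb

IsCycle : ∀ {W : FinSet} (H : Graph W) → Carrier W → List (Carrier W) → Set
IsCycle H x ys = 2 ≤ length ys × Unique (x ∷ ys) × Linked (Adj H) (x ∷ ys ++ x ∷ [])

module CycleFacts {W : FinSet} (H : Graph W) where
  open DecMembership (_≟_ W) using (_∈?_)
  open DecUnique (_≟_ W) using (unique?)
  open Pruning H using (Adj-sym)

  -- A non-backtracking walk that repeats a vertex contains a cycle: cut
  -- it at the first repetition of the earliest repeated vertex.
  repeat⇒cycle : (l : List (Carrier W)) → Linked (Adj H) l → NonBacktracking l → ¬ Unique l → HasCycle H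
  repeat⇒cycle []       _  _  nu = ⊥-elim (nu [])
  repeat⇒cycle (a ∷ l') lk nb nu with unique? l'
  ... | no nu' = repeat⇒cycle l' (LinkedM.tail lk) (NonBacktracking-tail l' nb) nu'
  ... | yes u' with a ∈? l'
  ...   | no nm = ⊥-elim (nu (¬Any⇒All¬ l' nm ∷ u'))
  ...   | yes m with split-first (_≟_ W) l' m
  ...     | ys , zs , refl , nin =
    a , ys , long ys lk nb , (¬Any⇒All¬ ys nin ∷ unique-prefix ys (a ∷ zs) u') , closed
    where
    closed : Linked (Adj H) (a ∷ ys ++ a ∷ [])
    closed = linked-prefix (a ∷ ys ++ a ∷ []) zs
               (subst (Linked (Adj H)) (cong (a ∷_) (sym (++-assoc ys (a ∷ []) zs))) lk)
    -- a loop of length ≤ 2 would need a self-loop or a backtrack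
    long : ∀ ys → Linked (Adj H) (a ∷ ys ++ a ∷ zs) → NonBacktracking (a ∷ ys ++ a ∷ zs) → 2 ≤ length ys
    long []           (r ∷ _) _        = ⊥-elim (true≢false r (adj-irrefl H a))
    long (b ∷ [])     _       (ne , _) = ⊥-elim (ne refl)
    long (b ∷ c ∷ ys) _       _        = s≤s (s≤s z≤n)

  rotate : ∀ x y rest → IsCycle H x (y ∷ rest) → IsCycle H y (rest ++ x ∷ [])
  rotate x y rest (le , (ax ∷ (ay ∷ u)) , (r ∷ lk)) =
    le' , (AllP.∷ʳ⁺ ay (λ e → All¬⇒¬Any ax (here (sym e))) ∷ unique-snoc rest u (All¬⇒¬Any (AllM.tail ax)))
        , linked-snoc y rest lk r
    where
    le' : 2 ≤ length (rest ++ x ∷ [])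
    le' = subst (2 ≤_) (sym (trans (length-++ rest) (+-comm (length rest) 1))) le

  head-nbrs : ∀ x ys → IsCycle H x ys → Σ (Carrier W) λ a → Σ (Carrier W) λ b →
              a ∈ ys × b ∈ ys × Adj H x a × Adj H x b × ¬ a ≡ b
  head-nbrs x (y ∷ [])    (s≤s (), _)
  head-nbrs x (y ∷ b ∷ l) (le , (_ ∷ (ay ∷ _)) , (r ∷ lk)) with linked-last b l (LinkedM.tail lk)
  ... | z , m , r' = y , z , here refl , there m , r , Adj-sym r' ,
                     (λ e → All¬⇒¬Any ay (subst (_∈ b ∷ l) (sym e) m))

  rotate-to : ∀ x pre suf {z} → z ∈ pre → IsCycle H x (pre ++ suf) →
              Σ (List (Carrier W)) λ ys' → IsCycle H z ys' × (∀ {w} → w ∈ z ∷ ys' → w ∈ x ∷ pre ++ suf)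
  rotate-to x (y ∷ pre) suf (here refl) c = (pre ++ suf) ++ x ∷ [] , rotate x y (pre ++ suf) c , same
    where
    same : ∀ {w} → w ∈ y ∷ (pre ++ suf) ++ x ∷ [] → w ∈ x ∷ y ∷ pre ++ suf
    same (here e) = there (here e)
    same (there m) with ∈-++⁻ (pre ++ suf) m
    ... | inj₁ q        = there (there q)
    ... | inj₂ (here e) = here e
  rotate-to x (y ∷ pre) suf (there m) c with rotate-to y pre (suf ++ x ∷ []) m
        (subst (IsCycle H y) (++-assoc pre suf (x ∷ [])) (rotate x y (pre ++ suf) c))
  ... | ys' , c' , sub = ys' , c' , λ w∈ → same (sub w∈)
    where
    same : ∀ {w} → w ∈ y ∷ pre ++ suf ++ x ∷ [] → w ∈ x ∷ y ∷ pre ++ suf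
    same (here e) = there (here e)
    same (there q) with ∈-++⁻ pre q
    ... | inj₁ q' = there (there (∈-++⁺ˡ q'))
    ... | inj₂ q' with ∈-++⁻ suf q'
    ...   | inj₁ q''        = there (there (∈-++⁺ʳ pre q''))
    ...   | inj₂ (here e)   = here e

  cycle-nbrs : ∀ x ys → IsCycle H x ys → ∀ {z} → z ∈ x ∷ ys → Σ (Carrier W) λ a → Σ (Carrier W) λ b →
               a ∈ x ∷ ys × b ∈ x ∷ ys × Adj H z a × Adj H z b × ¬ a ≡ b
  cycle-nbrs x ys c (here refl) with head-nbrs x ys c
  ... | a , b , ma , mb , ra , rb , ne = a , b , there ma , there mb , ra , rb , ne
  cycle-nbrs x ys c (there m) with rotate-to x ys [] m (subst (IsCycle H x) (sym (++-identityʳ ys)) c)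
  ... | ys' , c' , sub with head-nbrs _ ys' c'
  ... | a , b , ma , mb , ra , rb , ne = a , b , on (sub (there ma)) , on (sub (there mb)) , ra , rb , ne
    where
    on : ∀ {w} → w ∈ x ∷ ys ++ [] → w ∈ x ∷ ys
    on {w} q = subst (λ l → w ∈ x ∷ l) (++-identityʳ ys) q

-- Let S be a vertex set and "stop" a set with at most
-- one element, such that every non-stop vertex of S has, besides any
-- given S-neighbour, a second one.  If some non-stop vertex v ∈ S has two
-- distinct S-neighbours a, b, then H has a cycle: extend the walk v, a, …
-- forwards and b, v, a, … backwards without backtracking, for |W| steps or
-- until a stop vertex is reached.  A long walk repeats a vertex; if both
-- ends stop, they stop at the same vertex.  Either way repeat⇒cycle
-- applies.

module CycleSearch {W : FinSet} (H : Graph W) (S stop : VertexSet W)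
  (branching : ∀ v → S v ≡ true → stop v ≡ false → Pruning.twoNbrsIn H S v ≡ true) where
  open CycleFacts H
  open Pruning H using (Adj-sym; nbrIn; twoNbrsIn-witness)

  another : ∀ v p → S v ≡ true → stop v ≡ false → Σ (Carrier W) λ q → nbrIn S v q ≡ true × ¬ q ≡ p
  another v p sv tv with twoNbrsIn-witness S v (branching v sv tv)
  ... | a , b , na , nb , a≢b with (W ≟ a) p
  ...   | yes a≡p = b , nb , λ b≡p → a≢b (trans a≡p (sym b≡p))
  ...   | no a≢p  = a , na , a≢p

  next : Carrier W → Carrier W → Carrier W
  next v p = pick (λ q → nbrIn S v q ∧ not ⌊ (W ≟ q) p ⌋) (elems W) v

  next-sound : ∀ v p → S v ≡ true → stop v ≡ false → nbrIn S v (next v p) ≡ true × ¬ next v p ≡ p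
  next-sound v p sv tv with another v p sv tv
  ... | q , nq , q≢p =
    let k = pick-sound (λ q → nbrIn S v q ∧ not ⌊ (W ≟ q) p ⌋) (elems W) v (complete W q)
              (∧-intro nq (cong not (⌊⌋-false ((W ≟ q) p) q≢p)))
    in ∧-elimˡ k , ⌊⌋-false⇒¬ ((W ≟ next v p) p) (not-true (∧-elimʳ {nbrIn S v (next v p)} k))

  size : ℕ
  size = length (elems W)

  long⇒repeat : (l : List (Carrier W)) → size < length l → ¬ Unique l
  long⇒repeat l lt u = <-irrefl refl (<-≤-trans lt (unique-length-≤ l (elems W) u (λ {z} _ → complete W z)))

  forward forward-tail : ℕ → Carrier W → Carrier W → List (Carrier W)
  forward f p c = c ∷ forward-tail f p c
  forward-tail zero    p c = []
  forward-tail (suc f) p c = if stop c then [] else forward f c (next c p)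

  forward-sound : ∀ f p c → nbrIn S p c ≡ true →
                  Linked (Adj H) (p ∷ forward f p c) × NonBacktracking (p ∷ forward f p c) ×
                  ((f < length (forward f p c)) ⊎ (Σ (Carrier W) λ r → r ∈ forward f p c × stop r ≡ true))
  forward-sound zero    p c npc = (∧-elimˡ npc ∷ [-]) , tt , inj₁ (s≤s z≤n)
  forward-sound (suc f) p c npc with stop c in e
  ... | true  = (∧-elimˡ npc ∷ [-]) , tt , inj₂ (c , here refl , e)
  ... | false with next-sound c p (∧-elimʳ {adj H p c} npc) e
  ...   | nq , ne with forward-sound f c (next c p) nq
  ...     | lk , nb , ends = (∧-elimˡ npc ∷ lk) , ((λ q → ne (sym q)) , nb) ,
                             map⊎ s≤s (λ { (r , m , sr) → r , there m , sr }) ends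

  backward : ℕ → Carrier W → Carrier W → List (Carrier W) → List (Carrier W)
  backward zero    c p rest = c ∷ p ∷ rest
  backward (suc f) c p rest = if stop c then c ∷ p ∷ rest else backward f (next c p) c (p ∷ rest)

  backward-sound : ∀ f c p rest → S c ≡ true →
                   Linked (Adj H) (c ∷ p ∷ rest) → NonBacktracking (c ∷ p ∷ rest) →
                   Linked (Adj H) (backward f c p rest) × NonBacktracking (backward f c p rest) ×
                   (Σ (List (Carrier W)) λ pre → backward f c p rest ≡ pre ++ c ∷ p ∷ rest) ×
                   ((f + length (c ∷ p ∷ rest) ≤ length (backward f c p rest)) ⊎
                    (Σ (Carrier W) λ r → Σ (List (Carrier W)) λ rs → backward f c p rest ≡ r ∷ rs × stop r ≡ true))
  backward-sound zero c p rest sc lk nb = lk , nb , ([] , refl) , inj₁ ≤-refl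
  backward-sound (suc f) c p rest sc lk nb with stop c in e
  ... | true = lk , nb , ([] , refl) , inj₂ (c , p ∷ rest , refl , e)
  ... | false with next-sound c p sc e
  ...   | nq , ne with backward-sound f (next c p) c (p ∷ rest) (∧-elimʳ {adj H c (next c p)} nq)
                         (Adj-sym (∧-elimˡ nq) ∷ lk) (ne , nb)
  ...     | lk' , nb' , (pre , eq) , ends =
    lk' , nb' , (pre ++ next c p ∷ [] , trans eq (sym (++-assoc pre (next c p ∷ []) (c ∷ p ∷ rest)))) ,
    map⊎ (subst (_≤ length (backward f (next c p) c (p ∷ rest))) (+-suc f (length (c ∷ p ∷ rest)))) (λ x → x) ends

  find-cycle : (∀ r r' → stop r ≡ true → stop r' ≡ true → r ≡ r') → ∀ v → S v ≡ true → stop v ≡ false → HasCycle H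
  find-cycle one-stop v sv tv with twoNbrsIn-witness S v (branching v sv tv)
  ... | a , b , na , nb' , a≢b with forward-sound size v a na
  ...   | lk₁ , nb₁ , inj₁ lt = repeat⇒cycle (v ∷ forward size v a) lk₁ nb₁ (long⇒repeat _ (≤-trans lt (n≤1+n _)))
  ...   | lk₁ , nb₁ , inj₂ (r , rm , sr)
    with backward-sound size b v (forward size v a) (∧-elimʳ {adj H v b} nb')
                        (Adj-sym (∧-elimˡ nb') ∷ lk₁) ((λ e → a≢b (sym e)) , nb₁)
  ...     | lk , nb , _ , inj₁ le = repeat⇒cycle _ lk nb (long⇒repeat _ (≤-trans size<size+2+k le))
    where
    size<size+2+k : ∀ {k} → suc size ≤ size + suc k
    size<size+2+k {k} = subst (suc size ≤_) (sym (+-suc size k)) (s≤s (m≤m+n size k))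
  ...     | lk , nb , (pre , eq) , inj₂ (r' , rs , eq' , sr') = repeat⇒cycle _ lk nb twice
    where
    -- the forward stop vertex r occurs again after the backward stop vertex r'
    later : ∀ pre → r' ∷ rs ≡ pre ++ b ∷ v ∷ forward size v a → r ∈ rs
    later []        refl = there rm
    later (x ∷ pre) refl = ∈-++⁺ʳ pre (there (there rm))
    twice : ¬ Unique (backward size b v (forward size v a))
    twice u with subst Unique eq' u
    ... | r'∉rs ∷ _ = All¬⇒¬Any r'∉rs (subst (_∈ rs) (one-stop r r' sr sr') (later pre (trans (sym eq') eq)))

module CoreCycles {U : FinSet} (G : Graph U) where
  open Pruning G
  open CycleFacts G using (cycle-nbrs)

  cycle-alive : ∀ x ys → IsCycle G x ys → ∀ t {z} → z ∈ x ∷ ys → alive t z ≡ true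
  cycle-alive x ys c zero m = refl
  cycle-alive x ys c (suc t) {z} m with cycle-nbrs x ys c m
  ... | a , b , ma , mb , ra , rb , ne =
    ∧-intro (cycle-alive x ys c t m)
      (twoNbrsIn-intro (alive t) z a b (∧-intro ra (cycle-alive x ys c t ma)) (∧-intro rb (cycle-alive x ys c t mb)) ne)

  cycle⇒core : HasCycle G → Σ (Carrier U) λ v → core v ≡ true
  cycle⇒core (x , ys , c) = x , cycle-alive x ys c n (here refl)

  -- every core vertex has two core neighbours, so walking in the core finds a cycle
  core⇒cycle : ∀ v → core v ≡ true → HasCycle G
  core⇒cycle v cv = find-cycle (λ r r' ()) v cv refl
    where open CycleSearch G core (λ _ → false) (λ v cv _ → core-twoNbrs v cv)

  core-dichotomy : (Σ (Carrier U) λ v → core v ≡ true) ⊎ (∀ v → core v ≡ false)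
  core-dichotomy with any core (elems U) in q
  ... | true  = let (v , _ , c) = any-witness core (elems U) q in inj₁ (v , c)
  ... | false = inj₂ λ v → ¬true⇒false λ c → true≢false (any-intro core (elems U) (complete U v) c) q

  empty-core⇒acyclic : (∀ v → core v ≡ false) → ¬ HasCycle G
  empty-core⇒acyclic empty cycle = let (v , c) = cycle⇒core cycle in true≢false c (empty v)

HasCycle-cong : ∀ {U} (G H : Graph U) → G ≈G H → HasCycle G → HasCycle H
HasCycle-cong G H e (x , ys , l , u , k) = x , ys , l , u , LinkedM.map (λ {a} {b} r → trans (sym (e a b)) r) k

-- A (Q ∘ 𝒜)-structure on U consists of a partition blk of U
-- into blocks 0 … k-1, a rooted tree T_i on every block and a graph C on
-- the block indices.  Gluing produces the graph on U whose edges are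
-- the tree edges inside blocks and the edges ρ i — ρ j between roots
-- for every edge ij of C.

RootedTree : (W : FinSet) → Set
RootedTree W = Σ (Graph W) (λ G → IsTree G × Carrier W)

module Gluing {U : FinSet} {k : ℕ} (blk : Carrier U → Fin k)
             (str : (i : Fin k) → RootedTree (Fiber U blk i)) (C : Graph (FinS k)) where

  tree : (i : Fin k) → Graph (Fiber U blk i)
  tree i = proj₁ (str i)

  ρ : Fin k → Carrier U
  ρ i = proj₁ (proj₂ (proj₂ (str i)))

  ρ-blk : ∀ i → blk (ρ i) ≡ i
  ρ-blk i = ⌊⌋-true⇒ (blk (ρ i) ≟F i) (T⇒true (proj₂ (proj₂ (proj₂ (str i)))))

  inBlock : ∀ {u i} → blk u ≡ i → T ⌊ blk u ≟F i ⌋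
  inBlock {u} {i} e = true⇒T (⌊⌋-true (blk u ≟F i) e)

  blockOf : ∀ {u i} → T ⌊ blk u ≟F i ⌋ → blk u ≡ i
  blockOf {u} {i} t = ⌊⌋-true⇒ (blk u ≟F i) (T⇒true t)

  treeAdj : (i : Fin k) (u w : Carrier U) → T ⌊ blk u ≟F i ⌋ → T ⌊ blk w ≟F i ⌋ → Bool
  treeAdj i u w p q = adj (tree i) (u , p) (w , q)

  treeAdj-irrelevant : ∀ i u w p q p' q' → treeAdj i u w p q ≡ treeAdj i u w p' q'
  treeAdj-irrelevant i u w p q p' q' rewrite T-irrelevant p p' | T-irrelevant q q' = refl

  treeAdj-sym : ∀ i j → i ≡ j → ∀ u w p q p' q' → treeAdj i u w p q ≡ treeAdj j w u p' q'
  treeAdj-sym i .i refl u w p q p' q' = trans (adj-sym (tree i) (u , p) (w , q)) (treeAdj-irrelevant i w u q p p' q')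

  isRoot : Carrier U → Bool
  isRoot u = ⌊ (U ≟ u) (ρ (blk u)) ⌋

  rootAdj : Carrier U → Carrier U → Bool
  rootAdj u w = isRoot u ∧ isRoot w ∧ adj C (blk u) (blk w)

  gluedAdj′ : ∀ u w → Dec (blk u ≡ blk w) → Bool
  gluedAdj′ u w (yes e) = treeAdj (blk u) u w (inBlock refl) (inBlock (sym e))
  gluedAdj′ u w (no _) = rootAdj u w

  gluedAdj : Carrier U → Carrier U → Bool
  gluedAdj u w = gluedAdj′ u w (blk u ≟F blk w)

  rootAdj-sym : ∀ u w → rootAdj u w ≡ rootAdj w u
  rootAdj-sym u w with isRoot u | isRoot w
  ... | true | true = adj-sym C (blk u) (blk w)
  ... | true | false = refl
  ... | false | true = refl
  ... | false | false = refl

  gluedAdj′-sym : ∀ u w d d' → gluedAdj′ u w d ≡ gluedAdj′ w u d'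
  gluedAdj′-sym u w (yes e) (yes e') = treeAdj-sym (blk u) (blk w) e u w _ _ _ _
  gluedAdj′-sym u w (yes e) (no n) = ⊥-elim (n (sym e))
  gluedAdj′-sym u w (no n) (yes e) = ⊥-elim (n (sym e))
  gluedAdj′-sym u w (no n) (no n') = rootAdj-sym u w

  gluedAdj′-irrefl : ∀ u d → gluedAdj′ u u d ≡ false
  gluedAdj′-irrefl u (yes e) = trans (treeAdj-irrelevant (blk u) u u (inBlock refl) (inBlock (sym e)) (inBlock refl) (inBlock refl))
                                (adj-irrefl (tree (blk u)) (u , inBlock refl))
  gluedAdj′-irrefl u (no n) = ⊥-elim (n refl)

  glued : Graph U
  glued = record
    { adj = gluedAdj
    ; adj-sym = λ u w → gluedAdj′-sym u w (blk u ≟F blk w) (blk w ≟F blk u)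
    ; adj-irrefl = λ u → gluedAdj′-irrefl u (blk u ≟F blk u) }

  glued-inside : ∀ i u w (p : T ⌊ blk u ≟F i ⌋) (q : T ⌊ blk w ≟F i ⌋) → gluedAdj u w ≡ treeAdj i u w p q
  glued-inside i u w p q = go (blk u ≟F blk w)
    where
    go : (d : Dec (blk u ≡ blk w)) → gluedAdj′ u w d ≡ treeAdj i u w p q
    go (yes e) = helper (blk u) (blockOf p) _ _
      where
      helper : ∀ j → j ≡ i → ∀ p' q' → treeAdj j u w p' q' ≡ treeAdj i u w p q
      helper j refl p' q' = treeAdj-irrelevant j u w p' q' p q
    go (no n) = ⊥-elim (n (trans (blockOf p) (sym (blockOf q))))

  glued-across : ∀ u w → ¬ blk u ≡ blk w → gluedAdj u w ≡ rootAdj u w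
  glued-across u w n with blk u ≟F blk w
  ... | yes e = ⊥-elim (n e)
  ... | no _ = refl

  isRoot-ρ : ∀ i → isRoot (ρ i) ≡ true
  isRoot-ρ i = ⌊⌋-true ((U ≟ ρ i) (ρ (blk (ρ i)))) (cong ρ (sym (ρ-blk i)))

  isRoot⇒ρ : ∀ u → isRoot u ≡ true → u ≡ ρ (blk u)
  isRoot⇒ρ u e = ⌊⌋-true⇒ ((U ≟ u) (ρ (blk u))) e

  nonroot-same-block : ∀ u w → isRoot u ≡ false → gluedAdj u w ≡ true → blk u ≡ blk w
  nonroot-same-block u w nr e with blk u ≟F blk w
  ... | yes b = b
  ... | no _ rewrite nr = ⊥-elim (true≢false e refl)

  glued-roots : ∀ i j → gluedAdj (ρ i) (ρ j) ≡ adj C i j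
  glued-roots i j with i ≟F j
  ... | yes refl = trans (gluedAdj′-irrefl (ρ i) (blk (ρ i) ≟F blk (ρ i))) (sym (adj-irrefl C i))
  ... | no i≢j = begin
    gluedAdj (ρ i) (ρ j)           ≡⟨ glued-across (ρ i) (ρ j) (λ e → i≢j (trans (sym (ρ-blk i)) (trans e (ρ-blk j)))) ⟩
    rootAdj (ρ i) (ρ j)            ≡⟨ cong₂ (λ a b → a ∧ b ∧ adj C (blk (ρ i)) (blk (ρ j))) (isRoot-ρ i) (isRoot-ρ j) ⟩
    adj C (blk (ρ i)) (blk (ρ j))  ≡⟨ cong₂ (adj C) (ρ-blk i) (ρ-blk j) ⟩
    adj C i j                      ∎
    where open ≡-Reasoning

-- If every vertex of C has two distinct
-- neighbours, then the roots are never pruned, and no other vertex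
-- survives (it would give a cycle in its tree).  Hence the core of the
-- glued graph is the set of roots, which spans a copy of C; by pruning
-- invariance the glued graph is a Φ-graph iff C is.

TwoNbrs : ∀ {W : FinSet} → Graph W → Set
TwoNbrs {W} C = ∀ i → Σ (Carrier W) λ j → Σ (Carrier W) λ j' → Adj C i j × Adj C i j' × ¬ j ≡ j'

module GluedCore {U : FinSet} {k : ℕ} (blk : Carrier U → Fin k)
          (str : (i : Fin k) → RootedTree (Fiber U blk i)) (C : Graph (FinS k)) (twoNbrs : TwoNbrs C) where
  open Gluing blk str C public
  open Pruning glued public

  ρ-inj : ∀ {i j} → ρ i ≡ ρ j → i ≡ j
  ρ-inj {i} {j} e = trans (sym (ρ-blk i)) (trans (cong blk e) (ρ-blk j))

  -- roots keep two alive root neighbours in every round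
  roots-alive : ∀ t i → alive t (ρ i) ≡ true
  roots-alive zero i = refl
  roots-alive (suc t) i with twoNbrs i
  ... | j , j' , aj , aj' , ne = ∧-intro (roots-alive t i)
      (twoNbrsIn-intro (alive t) (ρ i) (ρ j) (ρ j') (∧-intro (trans (glued-roots i j) aj) (roots-alive t j))
              (∧-intro (trans (glued-roots i j') aj') (roots-alive t j')) (λ e → ne (ρ-inj e)))

  isRoot→core : ∀ u → isRoot u ≡ true → core u ≡ true
  isRoot→core u r = subst (λ z → core z ≡ true) (sym (isRoot⇒ρ u r)) (roots-alive n (blk u))

  -- Within block i consider, in the tree T_i, the core vertices and the
  -- root as the only stop vertex.  A non-root core vertex has two core
  -- neighbours, all inside its block, so it branches in T_i.
  module InBlock (i : Fin k) where
    coreIn rootIn : VertexSet (Fiber U blk i)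
    coreIn x = core (proj₁ x)
    rootIn x = isRoot (proj₁ x)

    core-branches : ∀ x → coreIn x ≡ true → rootIn x ≡ false → Pruning.twoNbrsIn (tree i) coreIn x ≡ true
    core-branches x cx rx with twoNbrsIn-witness core (proj₁ x) (core-twoNbrs (proj₁ x) cx)
    ... | a , b , na , nb , a≢b =
      Pruning.twoNbrsIn-intro (tree i) coreIn x (lift a na) (lift b nb) (lift-nbr a na) (lift-nbr b nb)
        (λ e → a≢b (cong proj₁ e))
      where
      lift : ∀ c → nbrIn core (proj₁ x) c ≡ true → Carrier (Fiber U blk i)
      lift c nc = c , inBlock (trans (sym (nonroot-same-block (proj₁ x) c rx (∧-elimˡ nc))) (blockOf (proj₂ x)))
      lift-nbr : ∀ c nc → Pruning.nbrIn (tree i) coreIn x (lift c nc) ≡ true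
      lift-nbr c nc = ∧-intro (trans (sym (glued-inside i (proj₁ x) c (proj₂ x) (proj₂ (lift c nc)))) (∧-elimˡ nc))
                              (∧-elimʳ {gluedAdj (proj₁ x) c} nc)

    one-root : ∀ r r' → rootIn r ≡ true → rootIn r' ≡ true → r ≡ r'
    one-root r r' e e' = subEq {U} {λ u → ⌊ blk u ≟F i ⌋}
      (trans (isRoot⇒ρ (proj₁ r) e) (trans (cong ρ (trans (blockOf (proj₂ r)) (sym (blockOf (proj₂ r')))))
        (sym (isRoot⇒ρ (proj₁ r') e'))))

    open CycleSearch (tree i) coreIn rootIn core-branches public using (find-cycle)

  -- ... so a non-root core vertex would give a cycle in its tree
  core→isRoot : ∀ v → core v ≡ true → isRoot v ≡ true
  core→isRoot v cv with bool-cases (isRoot v)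
  ... | inj₁ r  = r
  ... | inj₂ nr = ⊥-elim (proj₂ (proj₁ (proj₂ (str (blk v))))
                   (InBlock.find-cycle (blk v) (InBlock.one-root (blk v)) (v , inBlock refl) cv nr))

  core≡isRoot : ∀ v → core v ≡ isRoot v
  core≡isRoot v with bool-cases (core v)
  ... | inj₁ c = trans c (sym (core→isRoot v c))
  ... | inj₂ c = trans c (sym (¬true⇒false (λ r → true≢false (isRoot→core v r) c)))

  rootBij : Bij (Sub U isRoot) (FinS k)
  rootBij = record
    { to = λ u → blk (proj₁ u)
    ; from = λ i → ρ i , true⇒T (isRoot-ρ i)
    ; from∘to = λ u → subEq {U} {isRoot} (sym (isRoot⇒ρ (proj₁ u) (T⇒true (proj₂ u))))
    ; to∘from = ρ-blk }

  module GluedΦ (Φ : GraphSubspecies) (ec : EndpointClosed Φ) (Cconn : Connected C) where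
    treeWalk : ∀ i (x y : Carrier (Fiber U blk i)) → Star (Adj glued) (proj₁ x) (proj₁ y)
    treeWalk i x y = gmap proj₁ (λ {a} {b} e → trans (glued-inside i (proj₁ a) (proj₁ b) (proj₂ a) (proj₂ b)) e)
                          (proj₂ (proj₁ (proj₁ (proj₂ (str i)))) x y)

    glued-connected : Connected glued
    glued-connected = ρ (proj₁ Cconn) , λ u w →
      treeWalk (blk u) (u , inBlock refl) (proj₂ (proj₂ (str (blk u))))
      ◅◅ gmap ρ (λ {i} {j} e → trans (glued-roots i j) e) (proj₂ Cconn (blk u) (blk w))
      ◅◅ treeWalk (blk w) (proj₂ (proj₂ (str (blk w)))) (w , inBlock refl)

    open PruningΦ Φ ec glued glued-connected

    -- the glued graph is a Φ-graph iff the top graph is: both are its core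
    glued-Φ : Is Φ U glued ⇔ Is Φ (FinS k) C
    glued-Φ = ⇔-trans (core-invariant (ρ (proj₁ Cconn)) (roots-alive n (proj₁ Cconn)))
      (⇔-trans (IsInduced-cong core≡isRoot)
        (mk⇔ (λ i → ext-closed Φ (λ a b → glued-roots a b) (relabel-closed Φ rootBij (induced glued isRoot) i))
             (λ i → ext-closed Φ roots-glued (relabel-closed Φ (inverse rootBij) C i))))
      where
      roots-glued : ∀ (a b : Carrier (Sub U isRoot)) →
                    adj C (blk (proj₁ a)) (blk (proj₁ b)) ≡ gluedAdj (proj₁ a) (proj₁ b)
      roots-glued a b = trans (sym (glued-roots (blk (proj₁ a)) (blk (proj₁ b))))
        (cong₂ gluedAdj (sym (isRoot⇒ρ (proj₁ a) (T⇒true (proj₂ a)))) (sym (isRoot⇒ρ (proj₁ b) (T⇒true (proj₂ b)))))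

module Uniqueness (Q : ∀ W → Graph W → Set)
                  (cl : ∀ {U V} (σ : Bij U V) G → Q U G → Q V (relabelG σ G))
                  (Q⇒twoNbrs : ∀ {k} (C : Graph (FinS k)) → Q (FinS k) C → TwoNbrs C) where
  TopSpecies : Species
  TopSpecies = graphSpecies Q cl

  CompSpecies : Species
  CompSpecies = TopSpecies ∘ₛ rootedTreeSpecies

  module _ {U : FinSet} where
    gluedOf : CompStr TopSpecies rootedTreeSpecies U → Graph U
    gluedOf x = Gluing.glued (blk x) (str x) (proj₁ (top x))

    -- Two composite structures with the same glued graph are equal: the
    -- glued graph determines its core, i.e. the roots; a tree path never
    -- leaves a block, so blocks correspond through their roots; the trees
    -- are the glued graph inside blocks and the top graph is the glued
    -- graph on the roots.
    module SameGlued (x y : CompStr TopSpecies rootedTreeSpecies U) (same : gluedOf x ≈G gluedOf y) where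
      module X = GluedCore (blk x) (str x) (proj₁ (top x)) (Q⇒twoNbrs _ (proj₂ (top x)))
      module Y = GluedCore (blk y) (str y) (proj₁ (top y)) (Q⇒twoNbrs _ (proj₂ (top y)))
      -- both glued graphs have the same core, so the same roots
      same-roots : ∀ u → X.isRoot u ≡ Y.isRoot u
      same-roots u = trans (sym (X.core≡isRoot u)) (trans (alive-cong X.glued Y.glued same X.n u) (Y.core≡isRoot u))
      ρx⇒ρy : ∀ i → X.ρ i ≡ Y.ρ (blk y (X.ρ i))
      ρx⇒ρy i = Y.isRoot⇒ρ (X.ρ i) (trans (sym (same-roots (X.ρ i))) (X.isRoot-ρ i))
      ρy⇒ρx : ∀ j → Y.ρ j ≡ X.ρ (blk x (Y.ρ j))
      ρy⇒ρx j = X.isRoot⇒ρ (Y.ρ j) (trans (same-roots (Y.ρ j)) (Y.isRoot-ρ j))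
      match : Bij (FinS (k x)) (FinS (k y))
      match = record
        { to = λ i → blk y (X.ρ i)
        ; from = λ j → blk x (Y.ρ j)
        ; from∘to = λ i → trans (cong (blk x) (sym (ρx⇒ρy i))) (X.ρ-blk i)
        ; to∘from = λ j → trans (cong (blk y) (sym (ρy⇒ρx j))) (Y.ρ-blk j) }
      -- a tree edge of x never joins two different y-blocks: a non-root has
      -- all its neighbours in its own y-block, and two y-roots are never
      -- adjacent inside an x-tree (they would be the same x-root)
      edge-same-block : ∀ i (a m : Carrier (Fiber U (blk x) i)) → Adj (X.tree i) a m → blk y (proj₁ a) ≡ blk y (proj₁ m)
      edge-same-block i a m e with bool-cases (Y.isRoot (proj₁ a))
      ... | inj₂ nr = Y.nonroot-same-block (proj₁ a) (proj₁ m) nr glued-am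
        where
        glued-am : Y.gluedAdj (proj₁ a) (proj₁ m) ≡ true
        glued-am = trans (sym (same (proj₁ a) (proj₁ m))) (trans (X.glued-inside i (proj₁ a) (proj₁ m) (proj₂ a) (proj₂ m)) e)
      ... | inj₁ r = sym (Y.nonroot-same-block (proj₁ m) (proj₁ a) m-nonroot glued-ma)
        where
        x-am : X.gluedAdj (proj₁ a) (proj₁ m) ≡ true
        x-am = trans (X.glued-inside i (proj₁ a) (proj₁ m) (proj₂ a) (proj₂ m)) e
        glued-ma : Y.gluedAdj (proj₁ m) (proj₁ a) ≡ true
        glued-ma = trans (adj-sym Y.glued (proj₁ m) (proj₁ a)) (trans (sym (same (proj₁ a) (proj₁ m))) x-am)
        is-root : ∀ z → Y.isRoot (proj₁ z) ≡ true → proj₁ z ≡ X.ρ i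
        is-root z rz = trans (X.isRoot⇒ρ (proj₁ z) (trans (same-roots (proj₁ z)) rz)) (cong X.ρ (X.blockOf (proj₂ z)))
        m-nonroot : Y.isRoot (proj₁ m) ≡ false
        m-nonroot = ¬true⇒false λ rm → true≢false x-am (subst (λ z → X.gluedAdj (proj₁ a) z ≡ false)
                      (trans (is-root a r) (sym (is-root m rm))) (adj-irrefl X.glued (proj₁ a)))

      walk-same-block : ∀ i (a b : Carrier (Fiber U (blk x) i)) → Star (Adj (X.tree i)) a b → blk y (proj₁ a) ≡ blk y (proj₁ b)
      walk-same-block i a .a ε = refl
      walk-same-block i a b (_◅_ {j = m} e rest) = trans (edge-same-block i a m e) (walk-same-block i m b rest)

      blocks-match : ∀ u → blk y u ≡ blk y (X.ρ (blk x u))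
      blocks-match u = walk-same-block (blk x u) (u , X.inBlock refl) (proj₂ (proj₂ (str x (blk x u))))
              (proj₂ (proj₁ (proj₁ (proj₂ (str x (blk x u))))) _ _)
      blockBij : ∀ i → Bij (Fiber U (blk x) i) (Fiber U (blk y) (Bij.to match i))
      blockBij i = fibBij {U} {k x} {k y} {blk x} {blk y} match blocks-match i
      trees-match : ∀ i (p q : Carrier (Fiber U (blk y) (blk y (X.ρ i)))) →
             adj (relabelG (blockBij i) (X.tree i)) p q ≡ adj (Y.tree (blk y (X.ρ i))) p q
      trees-match i p q = trans (sym (X.glued-inside i (proj₁ p) (proj₁ q) (proj₂ (Bij.from (blockBij i) p)) (proj₂ (Bij.from (blockBij i) q))))
                     (trans (same (proj₁ p) (proj₁ q)) (Y.glued-inside _ (proj₁ p) (proj₁ q) (proj₂ p) (proj₂ q)))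
      roots-match : ∀ i → Bij.to (blockBij i) (proj₂ (proj₂ (str x i))) ≡ proj₂ (proj₂ (str y (blk y (X.ρ i))))
      roots-match i = subEq {U} {λ u → ⌊ blk y u ≟F blk y (X.ρ i) ⌋} (ρx⇒ρy i)
      tops-match : ∀ a b → adj (proj₁ (top x)) (blk x (Y.ρ a)) (blk x (Y.ρ b)) ≡ adj (proj₁ (top y)) a b
      tops-match a b = trans (sym (X.glued-roots (blk x (Y.ρ a)) (blk x (Y.ρ b))))
                   (trans (cong₂ X.gluedAdj (sym (ρy⇒ρx a)) (sym (ρy⇒ρx b)))
                     (trans (same (Y.ρ a) (Y.ρ b)) (Y.glued-roots a b)))

    same-glued⇒≈ : (x y : CompStr TopSpecies rootedTreeSpecies U) → gluedOf x ≈G gluedOf y → _≈_ CompSpecies x y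
    same-glued⇒≈ x y same = match , blocks-match , (λ i → trees-match i , roots-match i) , tops-match
      where open SameGlued x y same

    glued-cong : (x y : CompStr TopSpecies rootedTreeSpecies U) → _≈_ CompSpecies x y → gluedOf x ≈G gluedOf y
    glued-cong x y (β , blocks-match , trees-match , top-match) u w = by-block (blk x u ≟F blk x w)
      where
      module X = Gluing (blk x) (str x) (proj₁ (top x))
      module Y = Gluing (blk y) (str y) (proj₁ (top y))
      blockBij : ∀ i → Bij (Fiber U (blk x) i) (Fiber U (blk y) (Bij.to β i))
      blockBij i = fibBij {U} {k x} {k y} {blk x} {blk y} β blocks-match i
      same-root : ∀ u → X.ρ (blk x u) ≡ Y.ρ (blk y u)
      same-root u = trans (cong proj₁ (proj₂ (trees-match (blk x u)))) (cong Y.ρ (sym (blocks-match u)))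
      same-roots : ∀ u → X.isRoot u ≡ Y.isRoot u
      same-roots u = cong (λ z → ⌊ (U ≟ u) z ⌋) (same-root u)
      by-block : Dec (blk x u ≡ blk x w) → X.gluedAdj u w ≡ Y.gluedAdj u w
      by-block (yes e) = trans (X.glued-inside i u w (X.inBlock refl) (X.inBlock (sym e)))
                    (trans (X.treeAdj-irrelevant i u w _ _ (proj₂ (Bij.from (blockBij i) p')) (proj₂ (Bij.from (blockBij i) q')))
                      (trans (proj₁ (trees-match i) p' q') (sym (Y.glued-inside (Bij.to β i) u w (proj₂ p') (proj₂ q')))))
        where
        i = blk x u
        p' : Carrier (Fiber U (blk y) (Bij.to β i))
        p' = u , Y.inBlock (blocks-match u)
        q' : Carrier (Fiber U (blk y) (Bij.to β i))
        q' = w , Y.inBlock (trans (blocks-match w) (cong (Bij.to β) (sym e)))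
      by-block (no ne) = trans (X.glued-across u w ne)
                     (trans (cong₂ _∧_ (same-roots u) (cong₂ _∧_ (same-roots w) same-top)) (sym (Y.glued-across u w ne')))
        where
        ne' : ¬ blk y u ≡ blk y w
        ne' e = ne (trans (sym (Bij.from∘to β (blk x u))) (trans (cong (Bij.from β)
                     (trans (sym (blocks-match u)) (trans e (blocks-match w)))) (Bij.from∘to β (blk x w))))
        same-top : adj (proj₁ (top x)) (blk x u) (blk x w) ≡ adj (proj₁ (top y)) (blk y u) (blk y w)
        same-top = trans (cong₂ (adj (proj₁ (top x))) (sym (Bij.from∘to β (blk x u))) (sym (Bij.from∘to β (blk x w))))
               (trans (top-match _ _) (sym (cong₂ (adj (proj₁ (top y))) (blocks-match u) (blocks-match w))))

  glued-natural : ∀ {U V : FinSet} (σ : Bij U V) (x : CompStr TopSpecies rootedTreeSpecies U) →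
            gluedOf (relabel CompSpecies σ x) ≈G relabelG σ (gluedOf x)
  glued-natural {U} {V} σ x v v' = by-block (blk x (Bij.from σ v) ≟F blk x (Bij.from σ v'))
    where
    module X = Gluing (blk x) (str x) (proj₁ (top x))
    module Xσ = Gluing (blk (relabel CompSpecies σ x)) (str (relabel CompSpecies σ x)) (proj₁ (top x))
    same-roots : ∀ v → Xσ.isRoot v ≡ X.isRoot (Bij.from σ v)
    same-roots v = ⌊⌋-cong ((V ≟ v) (Xσ.ρ (blk x (Bij.from σ v)))) ((U ≟ Bij.from σ v) (X.ρ (blk x (Bij.from σ v))))
             (λ e → trans (cong (Bij.from σ) e) (Bij.from∘to σ _))
             (λ e → trans (sym (Bij.to∘from σ v)) (cong (Bij.to σ) e))
    by-block : (d : Dec (blk x (Bij.from σ v) ≡ blk x (Bij.from σ v'))) →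
         Xσ.gluedAdj′ v v' d ≡ X.gluedAdj′ (Bij.from σ v) (Bij.from σ v') d
    by-block (yes e) = refl
    by-block (no ne) = cong₂ _∧_ (same-roots v) (cong (_∧ adj (proj₁ (top x)) (blk x (Bij.from σ v)) (blk x (Bij.from σ v'))) (same-roots v'))

-- Let G be connected with nonempty core.
-- A non-core vertex v has exactly one neighbour surviving the round in
-- which v is pruned, its parent, which is pruned strictly later or lies
-- in the core.  Following parents leads every vertex to a core vertex,
-- its root.  The blocks (vertices with a common root) carry trees rooted
-- at core vertices, the core induces a graph without endpoints on at
-- least two vertices, and gluing these pieces gives back G.

module Decomposition {U : FinSet} (G : Graph U) (cg : Connected G) (c0 : Carrier U) (cc0 : Pruning.core G c0 ≡ true) where
  open Pruning G
  open CoreCycles G using (cycle-alive)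

  parent : Carrier U → Carrier U
  parent v = pick (λ w → adj G v w ∧ alive (lastAlive v) w) E v

  parent-sound : ∀ v → core v ≡ false → Adj G v (parent v) × alive (suc (lastAlive v)) (parent v) ≡ true
  parent-sound v cv = ∧-elimˡ pk , subst (λ z → alive (suc (lastAlive v)) z ≡ true) (sym eq) (proj₂ (proj₂ W))
    where
    t = lastAlive v
    av = alive-lastAlive v
    bv = noncore-pruned v cv
    W = pruned-survivorNbr cg t v c0 av bv (core-alive c0 cc0 (suc t))
    pk = pick-sound (λ w → adj G v w ∧ alive (lastAlive v) w) E v (complete U (proj₁ W))
           (∧-intro (proj₁ (proj₂ W)) (alive-shrinks t _ (proj₂ (proj₂ W))))
    eq : parent v ≡ proj₁ W
    eq = uniqueNbrIn (alive t) v (parent v) (proj₁ W) (pruned-fewNbrs t v av bv) pk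
           (∧-intro (proj₁ (proj₂ W)) (alive-shrinks t _ (proj₂ (proj₂ W))))

  parent-later : ∀ v → core v ≡ false → suc (lastAlive v) ≤ lastAlive (parent v)
  parent-later v cv = lastAlive-max (parent v) (suc (lastAlive v)) (noncore-lastAlive-< v cv) (proj₂ (parent-sound v cv))

  step : Carrier U → Carrier U
  step v = if core v then v else parent v

  step-core : ∀ v → core v ≡ true → step v ≡ v
  step-core v e = cong (λ b → if b then v else parent v) e

  step-noncore : ∀ v → core v ≡ false → step v ≡ parent v
  step-noncore v e = cong (λ b → if b then v else parent v) e

  climb : ℕ → Carrier U → Carrier U
  climb zero u = u
  climb (suc f) u = climb f (step u)

  climb-core : ∀ f u → core u ≡ true → climb f u ≡ u
  climb-core zero u c = refl
  climb-core (suc f) u c = trans (cong (climb f) (step-core u c)) (climb-core f u c)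

  climb-progress : ∀ f u → core (climb f u) ≡ true ⊎ f + lastAlive u ≤ lastAlive (climb f u)
  climb-progress zero u = inj₂ ≤-refl
  climb-progress (suc f) u with bool-cases (core u)
  ... | inj₁ c = inj₁ (subst (λ z → core z ≡ true) (sym (climb-core (suc f) u c)) c)
  ... | inj₂ c with climb-progress f (step u)
  ...   | inj₁ r = inj₁ r
  ...   | inj₂ le = inj₂ (≤-trans later le)
    where
    later : suc f + lastAlive u ≤ f + lastAlive (step u)
    later = ≤-trans (≤-reflexive (sym (+-suc f (lastAlive u))))
                    (+-monoʳ-≤ f (subst (λ z → suc (lastAlive u) ≤ lastAlive z) (sym (step-noncore u c)) (parent-later u c)))

  -- n steps certainly reach the core
  root : Carrier U → Carrier U
  root u = climb n u

  core-root : ∀ u → core (root u) ≡ true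
  core-root u with climb-progress n u
  ... | inj₁ r = r
  ... | inj₂ le = subst (λ s → alive s (root u) ≡ true) eqn (alive-lastAlive (root u))
    where
    eqn : lastAlive (root u) ≡ n
    eqn = ≤-antisym (lastAlive-≤ (root u)) (≤-trans (m≤m+n n (lastAlive u)) le)

  root-core : ∀ v → core v ≡ true → root v ≡ v
  root-core v c = climb-core n v c

  climb-stable : ∀ f u → core (climb f u) ≡ true → climb (suc f) u ≡ climb f u
  climb-stable zero u c = step-core u c
  climb-stable (suc f) u c = climb-stable f (step u) c

  root-step : ∀ u → root (step u) ≡ root u
  root-step u = climb-stable n u (core-root u)

  root-parent : ∀ u → core u ≡ false → root (parent u) ≡ root u
  root-parent u c = trans (cong root (sym (step-noncore u c))) (root-step u)

  only-parent : ∀ v w → core v ≡ false → Adj G v w → alive (lastAlive v) w ≡ true → w ≡ parent v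
  only-parent v w cv e aw = uniqueNbrIn (alive (lastAlive v)) v w (parent v)
    (pruned-fewNbrs (lastAlive v) v (alive-lastAlive v) (noncore-pruned v cv)) (∧-intro e aw)
    (∧-intro (proj₁ (parent-sound v cv)) (alive-shrinks (lastAlive v) (parent v) (proj₂ (parent-sound v cv))))

  -- an edge leaving a non-core vertex u goes to its parent or to a
  -- vertex whose parent is u; either way both ends have the same root
  noncore-edge : ∀ u w → core u ≡ false → Adj G u w → root u ≡ root w
  noncore-edge u w cu e with bool-cases (alive (lastAlive u) w)
  ... | inj₁ aw = sym (trans (cong root (only-parent u w cu e aw)) (root-parent u cu))
  ... | inj₂ aw = trans (cong root (only-parent w u cw (Adj-sym e) (alive-before-lastAlive u (lastAlive w) (<⇒≤ w<u))))
                        (root-parent w cw)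
    where
    w<u : lastAlive w < lastAlive u
    w<u with ≤-total (lastAlive u) (lastAlive w)
    ... | inj₁ le = ⊥-elim (true≢false (alive-before-lastAlive w (lastAlive u) le) aw)
    ... | inj₂ le with m≤n⇒m<n∨m≡n le
    ...   | inj₁ lt = lt
    ...   | inj₂ eq = ⊥-elim (true≢false (alive-before-lastAlive w (lastAlive u) (≤-reflexive (sym eq))) aw)
    cw : core w ≡ false
    cw = ¬true⇒false (λ c → <-irrefl refl (<-≤-trans w<u (≤-trans (lastAlive-≤ u) (≤-reflexive (sym (core-lastAlive c))))))
      where
      core-lastAlive : core w ≡ true → lastAlive w ≡ n
      core-lastAlive c = ≤-antisym (lastAlive-≤ w) (lastAlive-max w n ≤-refl c)

  edge-cases : ∀ u w → Adj G u w → (core u ≡ true × core w ≡ true) ⊎ root u ≡ root w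
  edge-cases u w e with bool-cases (core u) | bool-cases (core w)
  ... | inj₁ cu | inj₁ cw = inj₁ (cu , cw)
  ... | inj₂ cu | _ = inj₂ (noncore-edge u w cu e)
  ... | inj₁ cu | inj₂ cw = inj₂ (sym (noncore-edge w u cw (Adj-sym e)))

  -- blocks are indexed by an enumeration of the core
  CoreSet : FinSet
  CoreSet = Sub U core

  open Enumeration CoreSet public using (card) renaming (enumeration to en)

  rootInCore : Carrier U → Carrier CoreSet
  rootInCore u = root u , true⇒T (core-root u)

  block : Carrier U → Fin card
  block u = Bij.to en (rootInCore u)

  rootOf : Fin card → Carrier U
  rootOf i = proj₁ (Bij.from en i)

  rootOf-core : ∀ i → core (rootOf i) ≡ true
  rootOf-core i = T⇒true (proj₂ (Bij.from en i))

  block-rootOf : ∀ i → block (rootOf i) ≡ i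
  block-rootOf i = trans (cong (Bij.to en) (subEq {U} {core} (root-core (rootOf i) (rootOf-core i)))) (Bij.to∘from en i)

  core-rootOf : ∀ v → core v ≡ true → v ≡ rootOf (block v)
  core-rootOf v c = sym (trans (cong proj₁ (Bij.from∘to en (rootInCore v))) (root-core v c))

  block-step : ∀ u → block (step u) ≡ block u
  block-step u = cong (Bij.to en) (subEq {U} {core} (root-step u))

  block-root : ∀ u → block (root u) ≡ block u
  block-root u = cong (Bij.to en) (subEq {U} {core} (root-core (root u) (core-root u)))

  InBlock : Fin card → VertexSet U
  InBlock i u = ⌊ block u ≟F i ⌋

  Block : Fin card → FinSet
  Block i = Fiber U block i

  blockTree : (i : Fin card) → Graph (Block i)
  blockTree i = induced G (InBlock i)

  inBlockᵢ : ∀ {u i} → block u ≡ i → T (InBlock i u)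
  inBlockᵢ {u} {i} e = true⇒T (⌊⌋-true (block u ≟F i) e)

  blockOfᵢ : ∀ {u i} → T (InBlock i u) → block u ≡ i
  blockOfᵢ {u} {i} t = ⌊⌋-true⇒ (block u ≟F i) (T⇒true t)

  blockRoot : (i : Fin card) → Carrier (Block i)
  blockRoot i = rootOf i , inBlockᵢ (block-rootOf i)

  stepIn : ∀ i → Carrier (Block i) → Carrier (Block i)
  stepIn i x = step (proj₁ x) , inBlockᵢ (trans (block-step (proj₁ x)) (blockOfᵢ (proj₂ x)))

  step-walk : ∀ i x → Star (Adj (blockTree i)) x (stepIn i x)
  step-walk i x with bool-cases (core (proj₁ x))
  ... | inj₁ c = subst (Star (Adj (blockTree i)) x) (subEq {U} {InBlock i} (sym (step-core (proj₁ x) c))) ε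
  ... | inj₂ c = subst (λ z → adj G (proj₁ x) z ≡ true) (sym (step-noncore (proj₁ x) c))
                       (proj₁ (parent-sound (proj₁ x) c)) ◅ ε

  climb-walk : ∀ i f (x : Carrier (Block i)) →
               Σ (Carrier (Block i)) λ y → proj₁ y ≡ climb f (proj₁ x) × Star (Adj (blockTree i)) x y
  climb-walk i zero    x = x , refl , ε
  climb-walk i (suc f) x with climb-walk i f (stepIn i x)
  ... | y , eq , w = y , eq , (step-walk i x ◅◅ w)

  walk-to-root : ∀ i (x : Carrier (Block i)) → Star (Adj (blockTree i)) x (blockRoot i)
  walk-to-root i x with climb-walk i n x
  ... | y , eq , w = subst (Star (Adj (blockTree i)) x) (subEq {U} {InBlock i} yeq) w
    where
    yeq : proj₁ y ≡ rootOf i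
    yeq = trans eq (trans (core-rootOf (root (proj₁ x)) (core-root (proj₁ x)))
            (cong rootOf (trans (block-root (proj₁ x)) (blockOfᵢ (proj₂ x)))))

  -- a block is a tree: connected through its root, and a cycle in it
  -- would consist of core vertices of one block, i.e. only of its root
  block-isTree : ∀ i → IsTree (blockTree i)
  block-isTree i = (blockRoot i , λ x y → walk-to-root i x ◅◅ reverse (λ {a} {b} → back {a} {b}) (walk-to-root i y)) , acyclic
    where
    back : ∀ {a b} → Adj (blockTree i) a b → Adj (blockTree i) b a
    back {a} {b} e = trans (adj-sym G (proj₁ b) (proj₁ a)) e
    acyclic : ¬ HasCycle (blockTree i)
    acyclic (x , [] , () , _)
    acyclic (x , y₁ ∷ ys , le , un@(x∉ys ∷ _) , lk) =
      All¬⇒¬Any x∉ys (here (subEq {U} {InBlock i} (trans (on-cycle⇒root x (here refl))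
                                                         (sym (on-cycle⇒root y₁ (there (here refl)))))))
      where
      cycle-in-G : IsCycle G (proj₁ x) (map proj₁ (y₁ ∷ ys))
      cycle-in-G = subst (2 ≤_) (sym (length-map proj₁ (y₁ ∷ ys))) le
                 , UniqueP.map⁺ (subEq {U} {InBlock i}) un
                 , subst (Linked (Adj G)) (cong (proj₁ x ∷_) (map-++ proj₁ (y₁ ∷ ys) (x ∷ []))) (LinkedP.map⁺ lk)
      on-cycle⇒root : ∀ z → proj₁ z ∈ map proj₁ (x ∷ y₁ ∷ ys) → proj₁ z ≡ rootOf i
      on-cycle⇒root z m = trans (core-rootOf (proj₁ z) (cycle-alive (proj₁ x) (map proj₁ (y₁ ∷ ys)) cycle-in-G n m))
                                (cong rootOf (blockOfᵢ (proj₂ z)))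

  rootedBlock : (i : Fin card) → RootedTree (Block i)
  rootedBlock i = blockTree i , block-isTree i , blockRoot i

  coreGraph : Graph (FinS card)
  coreGraph = relabelG en (induced G core)

  -- core vertices have two core neighbours
  core-noEndpoints : NoEndpoints (induced G core)
  core-noEndpoints v (w , aw , uq) with twoNbrsIn-witness core (proj₁ v) (core-twoNbrs (proj₁ v) (T⇒true (proj₂ v)))
  ... | a , b , na , nbb , ne =
    ne (cong proj₁ (trans (uq (a , true⇒T (∧-elimʳ {adj G (proj₁ v) a} na)) (∧-elimˡ na))
                      (sym (uq (b , true⇒T (∧-elimʳ {adj G (proj₁ v) b} nbb)) (∧-elimˡ nbb)))))

  coreGraph-noEndpoints : NoEndpoints coreGraph
  coreGraph-noEndpoints = relabel-NoEndpoints en (induced G core) core-noEndpoints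

  coreGraph-twoVertices : AtLeastTwo (FinS card)
  coreGraph-twoVertices with twoNbrsIn-witness core c0 (core-twoNbrs c0 cc0)
  ... | a , b , na , nbb , ne = relabel-AtLeastTwo en
        ((c0 , true⇒T cc0) , (a , true⇒T (∧-elimʳ {adj G c0 a} na)) ,
         λ e → true≢false (subst (λ z → adj G c0 z ≡ true) (sym (cong proj₁ e)) (∧-elimˡ na)) (adj-irrefl G c0))

  module _ (Φ : GraphSubspecies) (ec : EndpointClosed Φ) where
    coreGraph-Φ : Is Φ U G → Is Φ (FinS card) coreGraph
    coreGraph-Φ i = relabel-closed Φ en (induced G core) (Equivalence.to (PruningΦ.core-invariant Φ ec G cg c0 cc0) i)

  module Glued = Gluing block rootedBlock coreGraph

  -- Gluing the blocks along the core graph gives back G: edges inside a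
  -- block are tree edges; other edges join two core vertices, i.e. roots.
  glue-decompose : Glued.glued ≈G G
  glue-decompose u w = go (block u ≟F block w)
    where
    go : (d : Dec (block u ≡ block w)) → Glued.gluedAdj′ u w d ≡ adj G u w
    go (yes e) = refl
    go (no ne) with bool-cases (adj G u w)
    ... | inj₁ e with edge-cases u w e
    ...   | inj₂ r = ⊥-elim (ne (cong (Bij.to en) (subEq {U} {core} r)))
    ...   | inj₁ (cu , cw) = trans (cong₂ _∧_ (is-root u cu) (cong₂ _∧_ (is-root w cw) refl))
                               (cong₂ (adj G) (sym (core-rootOf u cu)) (sym (core-rootOf w cw)))
      where
      is-root : ∀ v → core v ≡ true → Glued.isRoot v ≡ true
      is-root v cv = ⌊⌋-true ((U ≟ v) (rootOf (block v))) (core-rootOf v cv)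
    go (no ne) | inj₂ f = trans non-edge (sym f)
      where
      non-edge : Glued.isRoot u ∧ (Glued.isRoot w ∧ adj coreGraph (block u) (block w)) ≡ false
      non-edge with Glued.isRoot u in ru | Glued.isRoot w in rw
      ... | false | _     = refl
      ... | true  | false = refl
      ... | true  | true  = trans (cong₂ (adj G) (sym (Glued.isRoot⇒ρ u ru)) (sym (Glued.isRoot⇒ρ w rw))) f

-- In a connected graph without endpoints on at least two vertices,
-- every vertex has two distinct neighbours: it has a neighbour (walk to
-- another vertex), and a single neighbour would make it an endpoint.

twoNbrs-of-noEndpoints : ∀ {W : FinSet} (C : Graph W) → Connected C → NoEndpoints C → AtLeastTwo W → TwoNbrs C
twoNbrs-of-noEndpoints {W} C (_ , walk) noEnd (x , y , x≢y) i = from-walk (walk i other) i≢other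
  where
  other : Carrier W
  other = if ⌊ (W ≟ i) x ⌋ then y else x
  i≢other : ¬ i ≡ other
  i≢other with (W ≟ i) x
  ... | yes refl = x≢y
  ... | no i≢x   = i≢x
  from-walk : ∀ {j} → Star (Adj C) i j → ¬ i ≡ j → Σ (Carrier W) λ a → Σ (Carrier W) λ b → Adj C i a × Adj C i b × ¬ a ≡ b
  from-walk ε i≢i = ⊥-elim (i≢i refl)
  from-walk (_◅_ {j = a} ia _) _ with any (λ b → adj C i b ∧ not ⌊ (W ≟ b) a ⌋) (elems W) in q
  ... | true with any-witness _ (elems W) q
  ...   | b , _ , r = a , b , ia , ∧-elimˡ r ,
                      λ a≡b → true≢false (⌊⌋-true ((W ≟ b) a) (sym a≡b)) (not-true (∧-elimʳ {adj C i b} r))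
  from-walk (_◅_ {j = a} ia _) _ | false = ⊥-elim (noEnd i (a , ia , only-a))
    where
    only-a : ∀ z → Adj C i z → z ≡ a
    only-a z iz = decide ((W ≟ z) a) (λ z≡a → z≡a) λ z≢a →
      ⊥-elim (true≢false (any-intro _ (elems W) (complete W z) (∧-intro iz (cong not (⌊⌋-false ((W ≟ z) a) z≢a)))) q)

acyclic-relabel⁻ : ∀ {U V} (σ : Bij U V) (G : Graph U) → ¬ HasCycle (relabelG σ G) → ¬ HasCycle G
acyclic-relabel⁻ σ G acyclic cycle = relabel-NoCycle (inverse σ) (relabelG σ G) acyclic
  (HasCycle-cong G (relabelG (inverse σ) (relabelG σ G)) (λ x y → sym (cong₂ (adj G) (from∘to σ x) (from∘to σ y))) cycle)

-- Fix a
-- species Q of top graphs whose members are exactly the Φ-graphs without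
-- endpoints on at least two vertices (on the sets Fin k that index
-- blocks).

module CyclicPart (Φ : GraphSubspecies) (allC : AllConnected Φ) (ec : EndpointClosed Φ)
  (Q : ∀ W → Graph W → Set) (cl : ∀ {U V} (σ : Bij U V) G → Q U G → Q V (relabelG σ G))
  (Q-intro : ∀ {k} (C : Graph (FinS k)) → Is Φ (FinS k) C → NoEndpoints C → AtLeastTwo (FinS k) → Q (FinS k) C)
  (Q-elim : ∀ {k} (C : Graph (FinS k)) → Q (FinS k) C → Is Φ (FinS k) C × NoEndpoints C × AtLeastTwo (FinS k))
  where

  Q⇒twoNbrs : ∀ {k} (C : Graph (FinS k)) → Q (FinS k) C → TwoNbrs C
  Q⇒twoNbrs C q = let (is , noEnd , two) = Q-elim C q in twoNbrs-of-noEndpoints C (allC _ C is) noEnd two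

  open Uniqueness Q cl Q⇒twoNbrs public

  ΦGraph : FinSet → Set
  ΦGraph U = Σ (Graph U) (Is Φ U)

  HasCore : ∀ {U} → Graph U → Set
  HasCore {U} G = Σ (Carrier U) λ v → Pruning.core G v ≡ true

  module _ {U : FinSet} where
    decompose : (x : ΦGraph U) → HasCore (proj₁ x) → Str CompSpecies U
    decompose (G , i) (v , c) = record
      { k = card ; blk = block ; surj = λ j → rootOf j , block-rootOf j ; str = rootedBlock
      ; top = coreGraph , Q-intro coreGraph (coreGraph-Φ Φ ec i) coreGraph-noEndpoints coreGraph-twoVertices }
      where open Decomposition G (allC _ G i) v c

    glue-decompose : ∀ (x : ΦGraph U) c → gluedOf (decompose x c) ≈G proj₁ x
    glue-decompose (G , i) (v , c) = Decomposition.glue-decompose G (allC _ G i) v c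

    -- the glued graph is a Φ-graph since the top graph is
    glue : Str CompSpecies U → ΦGraph U
    glue y = gluedOf y , Equivalence.from (GluedCore.GluedΦ.glued-Φ (blk y) (str y) (proj₁ (top y)) (Q⇒twoNbrs _ q) Φ ec (allC _ _ is)) is
      where
      q = proj₂ (top y)
      is = proj₁ (Q-elim _ q)

    -- the roots of a glued graph lie in its core
    glued-hasCore : (y : Str CompSpecies U) → HasCore (gluedOf y)
    glued-hasCore y = _ , G.roots-alive G.n i₀
      where
      module G = GluedCore (blk y) (str y) (proj₁ (top y)) (Q⇒twoNbrs _ (proj₂ (top y)))
      i₀ = proj₁ (allC _ _ (proj₁ (Q-elim _ (proj₂ (top y)))))

    -- all further properties follow from injectivity of gluing
    decompose-cong : ∀ (x x' : ΦGraph U) c c' → proj₁ x ≈G proj₁ x' →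
                     _≈_ CompSpecies (decompose x c) (decompose x' c')
    decompose-cong x x' c c' e = same-glued⇒≈ (decompose x c) (decompose x' c')
      (λ a b → trans (glue-decompose x c a b) (trans (e a b) (sym (glue-decompose x' c' a b))))

    decompose-glue : ∀ (y : Str CompSpecies U) c → _≈_ CompSpecies (decompose (glue y) c) y
    decompose-glue y c = same-glued⇒≈ (decompose (glue y) c) y (glue-decompose (glue y) c)

  decompose-natural : ∀ {U V} (σ : Bij U V) (x : ΦGraph U) c c' →
                      _≈_ CompSpecies (decompose (relabel (asSpecies Φ) σ x) c') (relabel CompSpecies σ (decompose x c))
  decompose-natural σ x c c' = same-glued⇒≈ (decompose (relabel (asSpecies Φ) σ x) c') (relabel CompSpecies σ (decompose x c))
    (λ a b → trans (glue-decompose (relabel (asSpecies Φ) σ x) c' a b)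
      (trans (sym (glue-decompose x c (from σ a) (from σ b))) (sym (glued-natural σ (decompose x c) a b))))

-- Then every Φ-graph has a
-- nonempty core (otherwise it would reduce to the one-vertex graph), and
-- every Φ-graph on a block index set has at least two vertices, so
-- Φ_M and Φ_M≥2 agree there.

module WithoutOneVertex (Φ : GraphSubspecies) (allC : AllConnected Φ) (ec : EndpointClosed Φ)
                        (no1 : ¬ Is Φ (FinS 1) oneVertexGraph) where

  -- Φ-graphs are connected (so nonempty) and not the one-vertex graph
  twoVertices : ∀ {k} (C : Graph (FinS k)) → Is Φ (FinS k) C → AtLeastTwo (FinS k)
  twoVertices {zero} C i with proj₁ (allC _ C i)
  ... | ()
  twoVertices {suc zero} C i = ⊥-elim (no1 (ext-closed Φ no-edges i))
    where
    no-edges : ∀ a b → adj C a b ≡ false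
    no-edges fz fz = adj-irrefl C fz
  twoVertices {suc (suc m)} C i = fz , fs fz , λ ()

  open CyclicPart Φ allC ec (λ U G → Is Φ U G × NoEndpoints G)
    (λ σ G p → relabel-closed Φ σ G (proj₁ p) , relabel-NoEndpoints σ G (proj₂ p))
    (λ C is noEnd _ → is , noEnd) (λ C (is , noEnd) → is , noEnd , twoVertices C is)

  -- an empty core would make the one-vertex graph a Φ-graph
  hasCore : ∀ {U} (x : ΦGraph U) → HasCore (proj₁ x)
  hasCore (G , i) with CoreCycles.core-dichotomy G
  ... | inj₁ c     = c
  ... | inj₂ empty = ⊥-elim (no1 (Equivalence.to (PruningΦ.tree-invariant Φ ec G (allC _ G i) empty) i))

  iso : asSpecies Φ ≅ (Φ-M Φ ∘ₛ rootedTreeSpecies)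
  iso = record
    { to = λ x → decompose x (hasCore x)
    ; from = glue
    ; to-cong = λ {_} {x} {x'} e → decompose-cong x x' (hasCore x) (hasCore x') e
    ; from-cong = λ {_} {y} {y'} e → glued-cong y y' e
    ; from∘to = λ x → glue-decompose x (hasCore x)
    ; to∘from = λ y → decompose-glue y (hasCore (glue y))
    ; natural = λ σ x → decompose-natural σ x (hasCore x) (hasCore (relabel (asSpecies Φ) σ x)) }

-- A Φ-graph with nonempty core
-- decomposes as above; one with empty core is acyclic, i.e. a tree, and
-- conversely every tree is a Φ-graph (it reduces to the one-vertex graph).

module WithOneVertex (Φ : GraphSubspecies) (allC : AllConnected Φ) (ec : EndpointClosed Φ)
                     (one : Is Φ (FinS 1) oneVertexGraph) where

  open CyclicPart Φ allC ec (λ U G → (Is Φ U G × NoEndpoints G) × AtLeastTwo U)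
    (λ σ G p → (relabel-closed Φ σ G (proj₁ (proj₁ p)) , relabel-NoEndpoints σ G (proj₂ (proj₁ p)))
             , relabel-AtLeastTwo σ (proj₂ p))
    (λ C is noEnd two → (is , noEnd) , two) (λ C ((is , noEnd) , two) → is , noEnd , two)

  Target : Species
  Target = (Φ-M≥2 Φ ∘ₛ rootedTreeSpecies) +ₛ treeSpecies

  EmptyCore : ∀ {U} → Graph U → Set
  EmptyCore {U} G = ∀ v → Pruning.core G v ≡ false

  module _ {U : FinSet} where
    tree : (x : ΦGraph U) → EmptyCore (proj₁ x) → IsTree (proj₁ x)
    tree (G , i) empty = allC _ G i , CoreCycles.empty-core⇒acyclic G empty

    split : (x : ΦGraph U) → HasCore (proj₁ x) ⊎ EmptyCore (proj₁ x) → Str Target U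
    split x (inj₁ c)     = inj₁ (decompose x c)
    split x (inj₂ empty) = inj₂ (proj₁ x , tree x empty)

    dichotomy : (x : ΦGraph U) → HasCore (proj₁ x) ⊎ EmptyCore (proj₁ x)
    dichotomy x = CoreCycles.core-dichotomy (proj₁ x)

    toTarget : ΦGraph U → Str Target U
    toTarget x = split x (dichotomy x)

    fromTarget : Str Target U → ΦGraph U
    fromTarget (inj₁ y)      = glue y
    fromTarget (inj₂ (T , t)) = T , Equivalence.from (PruningΦ.tree-invariant Φ ec T (proj₁ t) empty) one
      where
      empty : EmptyCore T
      empty v = ¬true⇒false (λ c → proj₂ t (CoreCycles.core⇒cycle T v c))

    -- an empty and a nonempty core cannot coexist in equal or relabeled graphs
    split-cong : ∀ (x x' : ΦGraph U) → proj₁ x ≈G proj₁ x' → ∀ d d' → _≈_ Target (split x d) (split x' d')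
    split-cong x x' e (inj₁ c)       (inj₁ c')       = decompose-cong x x' c c' e
    split-cong x x' e (inj₂ _)       (inj₂ _)        = e
    split-cong x x' e (inj₁ (v , c)) (inj₂ empty)    = ⊥-elim
      (CoreCycles.empty-core⇒acyclic (proj₁ x') empty (HasCycle-cong (proj₁ x) (proj₁ x') e (CoreCycles.core⇒cycle (proj₁ x) v c)))
    split-cong x x' e (inj₂ empty)   (inj₁ (v , c))  = ⊥-elim
      (CoreCycles.empty-core⇒acyclic (proj₁ x) empty
        (HasCycle-cong (proj₁ x') (proj₁ x) (λ a b → sym (e a b)) (CoreCycles.core⇒cycle (proj₁ x') v c)))

    -- glued graphs have nonempty core; trees have empty core
    split-from : ∀ (y : Str Target U) d → _≈_ Target (split (fromTarget y) d) y
    split-from (inj₁ y)       (inj₁ c)       = decompose-glue y c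
    split-from (inj₁ y)       (inj₂ empty)   = let (v , c) = glued-hasCore y in ⊥-elim (true≢false c (empty v))
    split-from (inj₂ (T , t)) (inj₁ (v , c)) = ⊥-elim (proj₂ t (CoreCycles.core⇒cycle T v c))
    split-from (inj₂ (T , t)) (inj₂ _)       = λ _ _ → refl

    from-split : ∀ (x : ΦGraph U) d → proj₁ (fromTarget (split x d)) ≈G proj₁ x
    from-split x (inj₁ c) = glue-decompose x c
    from-split x (inj₂ _) = λ _ _ → refl

  -- relabeling preserves the summand (via acyclicity) and commutes with decompose
  split-natural : ∀ {U V} (σ : Bij U V) (x : ΦGraph U) d d' →
                  _≈_ Target (split (relabel (asSpecies Φ) σ x) d') (relabel Target σ (split x d))
  split-natural σ x (inj₁ c)       (inj₁ c')      = decompose-natural σ x c c'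
  split-natural σ x (inj₂ _)       (inj₂ _)       = λ _ _ → refl
  split-natural σ x (inj₁ (v , c)) (inj₂ empty)   =
    acyclic-relabel⁻ σ (proj₁ x) (CoreCycles.empty-core⇒acyclic (relabelG σ (proj₁ x)) empty)
      (CoreCycles.core⇒cycle (proj₁ x) v c)
  split-natural σ x (inj₂ empty)   (inj₁ (v , c)) =
    relabel-NoCycle σ (proj₁ x) (CoreCycles.empty-core⇒acyclic (proj₁ x) empty)
      (CoreCycles.core⇒cycle (relabelG σ (proj₁ x)) v c)

  iso : asSpecies Φ ≅ Target
  iso = record
    { to = toTarget
    ; from = fromTarget
    ; to-cong = λ {_} {x} {x'} e → split-cong x x' e (dichotomy x) (dichotomy x')
    ; from-cong = λ { {_} {inj₁ y} {inj₁ y'} e → glued-cong y y' e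
                    ; {_} {inj₂ _} {inj₂ _} e → e
                    ; {_} {inj₁ _} {inj₂ _} () ; {_} {inj₂ _} {inj₁ _} () }
    ; from∘to = λ x → from-split x (dichotomy x)
    ; to∘from = λ y → split-from y (dichotomy (fromTarget y))
    ; natural = λ σ x → split-natural σ x (dichotomy x) (dichotomy (relabel (asSpecies Φ) σ x)) }

theorem5p17 : (Φ : GraphSubspecies) → AllConnected Φ → EndpointClosed Φ →
    (Is Φ (FinS 1) oneVertexGraph →
       asSpecies Φ ≅ ((Φ-M≥2 Φ ∘ₛ rootedTreeSpecies) +ₛ treeSpecies))
    × (¬ Is Φ (FinS 1) oneVertexGraph →
       asSpecies Φ ≅ (Φ-M Φ ∘ₛ rootedTreeSpecies))
theorem5p17 Φ allC ec = (λ one → WithOneVertex.iso Φ allC ec one) , (λ no1 → WithoutOneVertex.iso Φ allC ec no1)
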